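{- (1) Let $S=S_1\bowtie_{{\tt H},{\tt K}}S_2$ be the system composed from communicating systems $S_1$ and $S_2$ (with disjoint role sets $\mathbf{P}_1\ni{\tt H}$ and $\mathbf{P}_2\ni{\tt K}$) whose CFSMs for the roles ${\tt H}$ and ${\tt K}$ are compatible. If $S_1$ and $S_2$ are both safe, then $S$ is safe. (2) Let $\mathbf{G}^{\mathbf{I}}=(\mathbf{G}_1^{\mathbf{H}}\bowtie_{{\tt H},{\tt K}}\mathbf{G}_2^{\mathbf{K}})^{\mathbf{I}}$ be the GTIR composed from GTIRs $\mathbf{G}_1^{\mathbf{H}}$ and $\mathbf{G}_2^{\mathbf{K}}$ via compatible interface roles ${\tt H}\in\mathbf{H}$, ${\tt K}\in\mathbf{K}$. If $[\![\mathbf{G}_1^{\mathbf{H}}]\!]$ and $[\![\mathbf{G}_2^{\mathbf{K}}]\!]$ are both safe, then $[\![\mathbf{G}^{\mathbf{I}}]\!]$ is safe.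
   Context: A CFSM over finite sets $\mathbf{P}$ of roles and $\mathbb{A}$ of messages is $M=(Q,q_0,\mathbb{A},\delta)$ with $Q$ finite, $q_0\in Q$, $\delta\subseteq Q\times Act\times Q$, $Act=C_\mathbf{P}\times\{!,?\}\times\mathbb{A}$, $C_\mathbf{P}=\{\mathtt{p}\mathtt{q}\mid \mathtt{p},\mathtt{q}\in\mathbf{P},\mathtt{p}\neq\mathtt{q}\}$. Label $\mathtt{s}\mathtt{r}!a$: $\mathtt{s}$ sends $a$ on channel $\mathtt{s}\mathtt{r}$; $\mathtt{s}\mathtt{r}?a$: $\mathtt{r}$ consumes $a$ from $\mathtt{s}\mathtt{r}$. $\mathcal{L}(M)$ is the language of $M$ with all states accepting. A state is final if it has no outgoing transition, sending (resp. receiving) if all outgoing transitions are sending (resp. receiving) actions, mixed otherwise. $M$ is ?-deterministic if for every state $q$, $(q,\mathtt{r}\mathtt{s}?a,q'),(q,\mathtt{p}\mathtt{q}?a,q'')\in\delta$ imply $q'=q''$; !-deterministic analogously; ?!-deterministic if both. A communicating system is $S=(M_\mathtt{p})_{\mathtt{p}\in\mathbf{P}}$, $M_\mathtt{p}=(Q_\mathtt{p},q_{0\mathtt{p}},\mathbb{A},\delta_\mathtt{p})$; configurations $(\vec q,\vec w)$ with a local state per role and a FIFO word $w_{\mathtt{p}\mathtt{q}}\in\mathbb{A}^*$ per channel; initial: initial states, empty channels; a send $\mathtt{s}\mathtt{r}!a$ by $\mathtt{s}$ appends $a$ to $w_{\mathtt{s}\mathtt{r}}$, a receive $\mathtt{s}\mathtt{r}?a$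 by $\mathtt{r}$ removes $a$ from the front of $w_{\mathtt{s}\mathtt{r}}$, all else unchanged. $RS(S)$: reachable configurations. Deadlock configuration: all channels empty and every local state receiving. Orphan-message configuration: every local state final and some channel nonempty. Unspecified reception configuration: some role $\mathtt{r}$ has $q_\mathtt{r}$ receiving and, for every $\mathtt{s}$ and every $(q_\mathtt{r},\mathtt{s}\mathtt{r}?a,q')\in\delta_\mathtt{r}$, $|w_{\mathtt{s}\mathtt{r}}|>0$ and $w_{\mathtt{s}\mathtt{r}}\notin a\mathbb{A}^*$. $S$ is safe if no configuration in $RS(S)$ is of any of these three kinds. $M\leftrightarrow M'$ (compatible) if $\mathcal{L}(M)^{\not C}=\overline{\mathcal{L}(M')^{\not C}}$ (channel names erased, $!$ and $?$ swapped), neither has mixed states, both ?!-deterministic. Gateway $\mathrm{gw}(M_{\tt H},{\tt K})$ for $M_{\tt H}=(Q,q_0,\mathbb{A},\delta)$: states $Q\cup\widehat Q$, one fresh state $q^t$ per $t=(q,l,q')\in\delta$; transitions: for $t=(q,{\tt H}\mathtt{s}!a,q')\in\delta$, $(q,{\tt K}{\tt H}?a,q^t),(q^t,{\tt H}\mathtt{s}!a,q')$; for $t=(q,\mathtt{s}{\tt H}?a,q')\in\delta$, $(q,\mathtt{s}{\tt H}?a,q^t),(q^t,{\tt H}{\tt K}!a,q')$; initial state $q_0$. Composition: for $S_1=(M^1_\mathtt{p})_{\mathtt{p}\in\mathbf{P}_1}$ over $\mathbf{P}_1,\mathbb{A}_1$ and $S_2=(M^2_\mathtt{p})_{\mathtt{p}\in\mathbf{P}_2}$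 over $\mathbf{P}_2,\mathbb{A}_2$ with $\mathbf{P}_1\cap\mathbf{P}_2=\emptyset$ and $M^1_{\tt H}\leftrightarrow M^2_{\tt K}$, $S_1\bowtie_{{\tt H},{\tt K}}S_2=(M_\mathtt{p})_{\mathtt{p}\in\mathbf{P}_1\cup\mathbf{P}_2}$ over $\mathbf{P}_1\cup\mathbf{P}_2$, $\mathbb{A}_1\cup\mathbb{A}_2$, with $M_{\tt H}=\mathrm{gw}(M^1_{\tt H},{\tt K})$, $M_{\tt K}=\mathrm{gw}(M^2_{\tt K},{\tt H})$, $M_\mathtt{p}=M^i_\mathtt{p}$ for the other $\mathtt{p}\in\mathbf{P}_i$. GTIRs: fix a global type formalism in which each global type $G$ has a finite role set $\mathbf{P}(G)$, a finite message set $\mathbb{A}(G)$, and for each $\mathtt{p}\in\mathbf{P}(G)$ a projection $G\!\upharpoonright\!\mathtt{p}$, a CFSM over $\mathbf{P}(G),\mathbb{A}(G)$. GTIRs $\mathbf{G}^{\mathbf{I}}$ (with interface role set $\mathbf{I}$), their role sets, components, projections and semantics $[\![\cdot]\!]$ are defined inductively: (base) $G^{\mathbf{I}}$ with $\mathbf{I}\subseteq\mathbf{P}(G)$ is a GTIR if no projection $G\!\upharpoonright\!\mathtt{p}$ has a transition labelled ${\tt I}{\tt J}!a$ or ${\tt I}{\tt J}?a$ with ${\tt I},{\tt J}\in\mathbf{I}$; its roles are $\mathbf{P}(G)$, its components $\{G\}$, and $[\![G^{\mathbf{I}}]\!]=(G\!\upharpoonright\!\mathtt{p})_{\mathtt{p}\in\mathbf{P}(G)}$.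 (composite) If $\mathbf{G}_1^{\mathbf{H}},\mathbf{G}_2^{\mathbf{K}}$ are GTIRs with disjoint role sets, ${\tt H}\in\mathbf{H}$, ${\tt K}\in\mathbf{K}$, and $\mathbf{I}=(\mathbf{H}\cup\mathbf{K})\setminus\{{\tt H},{\tt K}\}$, then $(\mathbf{G}_1^{\mathbf{H}}\bowtie_{{\tt H},{\tt K}}\mathbf{G}_2^{\mathbf{K}})^{\mathbf{I}}$ is a GTIR provided the interface roles are compatible, i.e. $\mathbf{G}_1^{\mathbf{H}}\!\upharpoonright\!{\tt H}\leftrightarrow\mathbf{G}_2^{\mathbf{K}}\!\upharpoonright\!{\tt K}$, where the projection of a GTIR onto a role $\mathtt{p}$ is $G\!\upharpoonright\!\mathtt{p}$ for the component $G$ with $\mathtt{p}\in\mathbf{P}(G)$; its roles and components are the unions of those of $\mathbf{G}_1^{\mathbf{H}},\mathbf{G}_2^{\mathbf{K}}$, and its semantics is $[\![\mathbf{G}_1^{\mathbf{H}}]\!]\bowtie_{{\tt H},{\tt K}}[\![\mathbf{G}_2^{\mathbf{K}}]\!]$. -}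

module Defs where

open import Level using (Level)
open import Data.Nat using (ℕ; _+_)
open import Data.Fin using (Fin; zero; suc)
open import Data.Fin.Properties using (+↔⊎; inj⇒≟)
open import Data.Sum using (_⊎_; inj₁; inj₂)
open import Data.Sum.Function.Propositional using (_⊎-↔_)
open import Data.Product using (Σ; Σ-syntax; ∃; ∃-syntax; _×_; _,_; proj₁; proj₂)
open import Data.List using (List; []; _∷_; _++_; map; length; [_])
open import Data.List.Membership.Propositional using (_∈_)
open import Data.Empty using (⊥)
open import Relation.Nullary using (¬_; yes; no)
open import Relation.Binary using (DecidableEquality)
open import Relation.Binary.PropositionalEquality using (_≡_; _≢_)
open import Relation.Binary.Construct.Closure.ReflexiveTransitive using (Star)
open import Function.Bundles using (_↔_)
open import Function.Properties.Inverse using (↔-sym; ↔-trans; ↔⇒↣; ↔-refl)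

record FinSet : Set₁ where
  field
    Carrier : Set
    size    : ℕ
    enum    : Carrier ↔ Fin size

open FinSet public

decEq : (X : FinSet) → DecidableEquality (Carrier X)
decEq X = inj⇒≟ (↔⇒↣ (enum X))

_⊎F_ : FinSet → FinSet → FinSet
X ⊎F Y = record
  { Carrier = Carrier X ⊎ Carrier Y
  ; size    = size X + size Y
  ; enum    = ↔-trans (enum X ⊎-↔ enum Y) (↔-sym +↔⊎) }

-- Actions  s r ! a  /  s r ? a   (channel s r, direction, message)

data Dir : Set where
  snd rcv : Dir

dual : Dir → Dir
dual snd = rcv
dual rcv = snd

record Act (R A : Set) : Set where
  constructor act
  field
    from : R
    to   : R
    dir  : Dir
    msg  : A
open Act public

mapAct : ∀ {R R' A} → (R → R') → Act R A → Act R' A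
mapAct f (act s r d a) = act (f s) (f r) d a

-- CFSMs  M = (Q, q0, 𝔸, δ)  over roles R and messages A.
-- Q is a finite set, δ ⊆ Q × Act × Q is given as a finite list.

Trans : Set → Set → Set → Set
Trans Q R A = Q × Act R A × Q

record CFSM (R A : Set) : Set₁ where
  field
    St : FinSet
    q0 : Carrier St
    δ  : List (Trans (Carrier St) R A)
open CFSM public

State : ∀ {R A} → CFSM R A → Set
State M = Carrier (St M)

liftCFSM : ∀ {R R' A} → (R → R') → CFSM R A → CFSM R' A
liftCFSM f M = record
  { St = St M ; q0 = q0 M
  ; δ  = map (λ { (q , l , q') → (q , mapAct f l , q') }) (δ M) }

-- runs and language (all states accepting)
data Path {R A} (M : CFSM R A) : State M → List (Act R A) → State M → Set where
  [] : ∀ {q} → Path M q [] q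
  _∷_ : ∀ {q l q' w q''} → (q , l , q') ∈ δ M → Path M q' w q'' → Path M q (l ∷ w) q''

InL : ∀ {R A} → CFSM R A → List (Act R A) → Set
InL M w = ∃[ q ] Path M (q0 M) w q

erase : ∀ {R A} → Act R A → Dir × A
erase l = dir l , msg l

InLnC : ∀ {R A} → CFSM R A → List (Dir × A) → Set
InLnC M u = ∃[ w ] (InL M w × map erase w ≡ u)

dualW : ∀ {A : Set} → List (Dir × A) → List (Dir × A)
dualW = map (λ { (d , a) → dual d , a })

Outgoing : ∀ {R A} (M : CFSM R A) → State M → Act R A → Set
Outgoing M q l = ∃[ q' ] ((q , l , q') ∈ δ M)

Final : ∀ {R A} (M : CFSM R A) → State M → Set
Final M q = ∀ l → ¬ Outgoing M q l

IsDir : ∀ {R A} (d : Dir) (M : CFSM R A) → State M → Set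
IsDir d M q = (¬ Final M q) × (∀ l → Outgoing M q l → dir l ≡ d)

Sending Receiving : ∀ {R A} (M : CFSM R A) → State M → Set
Sending   = IsDir snd
Receiving = IsDir rcv

Mixed : ∀ {R A} (M : CFSM R A) → State M → Set
Mixed M q = ¬ Final M q × ¬ Sending M q × ¬ Receiving M q

NoMixed : ∀ {R A} → CFSM R A → Set
NoMixed M = ∀ q → ¬ Mixed M q

Det : ∀ {R A} → Dir → CFSM R A → Set
Det {R} {A} d M = ∀ {q q' q''} {s r s' r' : R} {a : A} →
  (q , act s r d a , q') ∈ δ M → (q , act s' r' d a , q'') ∈ δ M → q' ≡ q''

QEDet : ∀ {R A} → CFSM R A → Set
QEDet M = Det rcv M × Det snd M

Compatible : ∀ {R R' A} → CFSM R A → CFSM R' A → Set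
Compatible M M' =
  (∀ u → InLnC M u → InLnC M' (dualW u)) ×
  (∀ u → InLnC M' (dualW u) → InLnC M u) ×
  NoMixed M × NoMixed M' × QEDet M × QEDet M'

record System (P : FinSet) (A : Set) : Set₁ where
  constructor sys
  field
    machine : Carrier P → CFSM (Carrier P) A
open System public

WellFormed : ∀ {P A} → System P A → Set
WellFormed {P} S = ∀ (p : Carrier P) {q l q'} → (q , l , q') ∈ δ (machine S p) →
  (from l ≢ to l) × (dir l ≡ snd → from l ≡ p) × (dir l ≡ rcv → to l ≡ p)

record Config {P A} (S : System P A) : Set where
  field
    st : (p : Carrier P) → State (machine S p)
    ch : Carrier P → Carrier P → List A
open Config public

IsInitial : ∀ {P A} {S : System P A} → Config S → Set
IsInitial {P} {S = S} c =
  (∀ p → st c p ≡ q0 (machine S p)) × (∀ (x y : Carrier P) → ch c x y ≡ [])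

Frame : ∀ {P A} {S : System P A} → Carrier P → Carrier P → Carrier P →
        Config S → Config S → Set
Frame {P} p s r c c' =
  (∀ p' → p' ≢ p → st c' p' ≡ st c p') ×
  (∀ (x y : Carrier P) → ¬ (x ≡ s × y ≡ r) → ch c' x y ≡ ch c x y)

data Step {P A} {S : System P A} (c c' : Config S) : Set where
  send : ∀ p s r a q' → (st c p , act s r snd a , q') ∈ δ (machine S p) → s ≡ p →
         st c' p ≡ q' → ch c' s r ≡ ch c s r ++ [ a ] → Frame p s r c c' →
         Step c c'
  recv : ∀ p s r a q' → (st c p , act s r rcv a , q') ∈ δ (machine S p) → r ≡ p →
         st c' p ≡ q' → ch c s r ≡ a ∷ ch c' s r → Frame p s r c c' →
         Step c c'

Reachable : ∀ {P A} (S : System P A) → Config S → Set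
Reachable S c = ∃[ c₀ ] (IsInitial c₀ × Star (Step {S = S}) c₀ c)

Deadlock : ∀ {P A} {S : System P A} → Config S → Set
Deadlock {P} {S = S} c =
  (∀ (x y : Carrier P) → x ≢ y → ch c x y ≡ []) × (∀ p → Receiving (machine S p) (st c p))

OrphanMessage : ∀ {P A} {S : System P A} → Config S → Set
OrphanMessage {P} {S = S} c =
  (∀ p → Final (machine S p) (st c p)) × (∃[ x ] ∃[ y ] (x ≢ y × ch c x y ≢ []))

UnspecifiedReception : ∀ {P A} {S : System P A} → Config S → Set
UnspecifiedReception {P} {A} {S} c = ∃[ r ] (Receiving (machine S r) (st c r) ×
  (∀ (s : Carrier P) (a : A) q' → (st c r , act s r rcv a , q') ∈ δ (machine S r) →
     (ch c s r ≢ []) × ¬ (∃[ w ] (ch c s r ≡ a ∷ w))))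

Safe : ∀ {P A} → System P A → Set
Safe S = ∀ c → Reachable S c →
  ¬ Deadlock c × ¬ OrphanMessage c × ¬ UnspecifiedReception c

-- Gateway  gw(M_H, K), built inside an ambient role type R'
-- (f embeds the roles of M_H into R'; K' is the partner role in R').

module _ {R R' A : Set} (f : R → R') (_≟_ : DecidableEquality R) (H : R) (K' : R') where

  gwStep : ∀ {Q X : Set} → Trans Q R A → X → List (Trans (Q ⊎ X) R' A)
  gwStep (q , act x y snd a , q') i with x ≟ H
  ... | yes _ = (inj₁ q , act K' (f H) rcv a , inj₂ i)
              ∷ (inj₂ i , act (f H) (f y) snd a , inj₁ q') ∷ []
  ... | no  _ = []
  gwStep (q , act x y rcv a , q') i with y ≟ H
  ... | yes _ = (inj₁ q , act (f x) (f H) rcv a , inj₂ i)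
              ∷ (inj₂ i , act (f H) K' snd a , inj₁ q') ∷ []
  ... | no  _ = []

  shiftT : ∀ {Q n} → Trans (Q ⊎ Fin n) R' A → Trans (Q ⊎ Fin (Data.Nat.suc n)) R' A
  shiftT (q , l , q') = sh q , l , sh q'
    where
      sh : _ → _
      sh (inj₁ x) = inj₁ x
      sh (inj₂ j) = inj₂ (suc j)

  -- one fresh state  q^t  (index of t in δ) per transition t
  gwTrans : ∀ {Q} → (ts : List (Trans Q R A)) → List (Trans (Q ⊎ Fin (length ts)) R' A)
  gwTrans [] = []
  gwTrans (t ∷ ts) = gwStep t zero ++ map shiftT (gwTrans ts)

  gateway : (M : CFSM R A) → CFSM R' A
  gateway M = record
    { St = St M ⊎F record { Carrier = Fin (length (δ M)) ; size = length (δ M)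
                          ; enum = ↔-refl }
    ; q0 = inj₁ (q0 M)
    ; δ  = gwTrans (δ M) }

compose : ∀ {P₁ P₂ A} → System P₁ A → System P₂ A →
          Carrier P₁ → Carrier P₂ → System (P₁ ⊎F P₂) A
compose {P₁} {P₂} S₁ S₂ H K = sys M
  where
    M : Carrier (P₁ ⊎F P₂) → CFSM (Carrier (P₁ ⊎F P₂)) _
    M (inj₁ p) with decEq P₁ p H
    ... | yes _ = gateway inj₁ (decEq P₁) H (inj₂ K) (machine S₁ H)
    ... | no  _ = liftCFSM inj₁ (machine S₁ p)
    M (inj₂ p) with decEq P₂ p K
    ... | yes _ = gateway inj₂ (decEq P₂) K (inj₁ H) (machine S₂ K)
    ... | no  _ = liftCFSM inj₂ (machine S₂ p)

record GTFormalism (A : Set) : Set₁ where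
  field
    GT    : Set
    roles : GT → FinSet
    proj  : (G : GT) → (p : Carrier (roles G)) → CFSM (Carrier (roles G)) A
open GTFormalism public

NoIfaceComm : ∀ {A} (F : GTFormalism A) (G : GT F) → (Carrier (roles F G) → Set) → Set
NoIfaceComm F G I = ∀ p {q l q'} → (q , l , q') ∈ δ (proj F G p) → I (from l) → I (to l) → ⊥

ifaceComp : ∀ {P₁ P₂ : FinSet} → (Carrier P₁ → Set) → (Carrier P₂ → Set) →
            Carrier P₁ → Carrier P₂ → Carrier (P₁ ⊎F P₂) → Set
ifaceComp Hs Ks H K (inj₁ x) = Hs x × x ≢ H
ifaceComp Hs Ks H K (inj₂ y) = Ks y × y ≢ K

module _ {A : Set} (F : GTFormalism A) where

  data GTIR : Set₁
  rolesGTIR : GTIR → FinSet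
  ifaceGTIR : (𝐆 : GTIR) → Carrier (rolesGTIR 𝐆) → Set
  projGTIR  : (𝐆 : GTIR) → Carrier (rolesGTIR 𝐆) → Σ[ Q ∈ FinSet ] CFSM (Carrier Q) A

  data GTIR where
    base : (G : GT F) (I : Carrier (roles F G) → Set) → NoIfaceComm F G I → GTIR
    comp : (𝐆₁ 𝐆₂ : GTIR)
           (H : Carrier (rolesGTIR 𝐆₁)) → ifaceGTIR 𝐆₁ H →
           (K : Carrier (rolesGTIR 𝐆₂)) → ifaceGTIR 𝐆₂ K →
           Compatible (proj₂ (projGTIR 𝐆₁ H)) (proj₂ (projGTIR 𝐆₂ K)) →
           GTIR

  rolesGTIR (base G I _) = roles F G
  rolesGTIR (comp 𝐆₁ 𝐆₂ _ _ _ _ _) = rolesGTIR 𝐆₁ ⊎F rolesGTIR 𝐆₂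

  ifaceGTIR (base G I _) = I
  ifaceGTIR (comp 𝐆₁ 𝐆₂ H _ K _ _) = ifaceComp {rolesGTIR 𝐆₁} {rolesGTIR 𝐆₂} (ifaceGTIR 𝐆₁) (ifaceGTIR 𝐆₂) H K

  projGTIR (base G I _) p = roles F G , proj F G p
  projGTIR (comp 𝐆₁ 𝐆₂ H _ K _ _) (inj₁ p) = projGTIR 𝐆₁ p
  projGTIR (comp 𝐆₁ 𝐆₂ H _ K _ _) (inj₂ p) = projGTIR 𝐆₂ p

  ⟦_⟧ : (𝐆 : GTIR) → System (rolesGTIR 𝐆) A
  ⟦ base G I _ ⟧ = sys (proj F G)
  ⟦ comp 𝐆₁ 𝐆₂ H _ K _ _ ⟧ = compose ⟦ 𝐆₁ ⟧ ⟦ 𝐆₂ ⟧ H K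

module Submission where

-- Let S = S₁ ⋈_{H,K} S₂ where the interface machines M = M_H and N = M_K are compatible.
-- (a) Projection (module Side): reading the state of H's gateway as a state of M and forgetting
--     the other side, every step of S is simulated by at most one step of S₁, so reachable
--     configurations of S project to reachable configurations of S₁ (and likewise for S₂).
-- (b) Interface invariant (Side.Explains, Composition.Safety.invariant): in every reachable
--     configuration there are runs w̃ of M and ũ of N such that what each has received is what the
--     other has sent followed by the messages in transit through the gateways.
-- (c) Compatibility (Interface.InTransit): since M and N are dual, deterministic and free of mixed
--     states, such runs are aligned up to a run of only sends or only receives; hence M and N are
--     never both waiting to send with nothing in transit, a message in transit has a non-final
--     receiver, and a machine waiting to send can send the message its partner forwards.
-- A deadlock, orphan message or unspecified reception of S thus either projects to one of S₁ or
-- S₂, or contradicts (c). For GTIRs, an interface role of the semantics runs a relabelling of its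
-- projection, which behaves the same (interface-behaviour), so part (2) reduces to part (1).

open import Defs

open import Axiom.UniquenessOfIdentityProofs.WithK using (uip)
open import Data.Empty using (⊥; ⊥-elim)
open import Data.Fin using (Fin; zero; suc)
open import Data.List using (List; []; _∷_; _++_; map; length; [_]; lookup)
open import Data.List.Membership.Propositional using (_∈_)
open import Data.List.Membership.Propositional.Properties using (∈-map⁺; ∈-map⁻; ∈-++⁺ʳ; ∈-++⁻; ∈-lookup)
open import Data.List.Properties
  using (∷-injectiveˡ; ∷-injectiveʳ; map-++; ++-assoc; ++-identityʳ; ++-identityʳ-unique;
         ++-cancelˡ; ++-conicalˡ; ++-conicalʳ)
open import Data.List.Relation.Unary.Any using (here; there; index)
open import Data.List.Relation.Unary.Any.Properties using (lookup-index)
open import Data.Product using (∃; _×_; _,_; proj₁; proj₂)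
open import Data.Sum using (_⊎_; inj₁; inj₂)
open import Data.Sum.Properties using (inj₁-injective; inj₂-injective)
open import Relation.Binary using (DecidableEquality)
open import Relation.Binary.Construct.Closure.ReflexiveTransitive using (Star; ε; _◅_; _◅◅_)
open import Relation.Binary.PropositionalEquality hiding ([_])
open import Relation.Nullary using (¬_; yes; no; Dec)

⌊_⌋ : ∀ {R A : Set} → List (Act R A) → List (Dir × A)
⌊_⌋ = map erase

received sent : ∀ {A : Set} → List (Dir × A) → List A
received [] = []
received ((snd , a) ∷ u) = received u
received ((rcv , a) ∷ u) = a ∷ received u
sent [] = []
sent ((snd , a) ∷ u) = a ∷ sent u
sent ((rcv , a) ∷ u) = sent u

module _ {A : Set} where

  received-++ : (u v : List (Dir × A)) → received (u ++ v) ≡ received u ++ received v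
  received-++ [] v = refl
  received-++ ((snd , a) ∷ u) v = received-++ u v
  received-++ ((rcv , a) ∷ u) v = cong (a ∷_) (received-++ u v)

  sent-++ : (u v : List (Dir × A)) → sent (u ++ v) ≡ sent u ++ sent v
  sent-++ [] v = refl
  sent-++ ((snd , a) ∷ u) v = cong (a ∷_) (sent-++ u v)
  sent-++ ((rcv , a) ∷ u) v = sent-++ u v

  received-dual : (u : List (Dir × A)) → received (dualW u) ≡ sent u
  received-dual [] = refl
  received-dual ((snd , a) ∷ u) = cong (a ∷_) (received-dual u)
  received-dual ((rcv , a) ∷ u) = received-dual u

  sent-dual : (u : List (Dir × A)) → sent (dualW u) ≡ received u
  sent-dual [] = refl
  sent-dual ((snd , a) ∷ u) = sent-dual u
  sent-dual ((rcv , a) ∷ u) = cong (a ∷_) (sent-dual u)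

  dualW-involutive : (u : List (Dir × A)) → dualW (dualW u) ≡ u
  dualW-involutive [] = refl
  dualW-involutive ((snd , a) ∷ u) = cong ((snd , a) ∷_) (dualW-involutive u)
  dualW-involutive ((rcv , a) ∷ u) = cong ((rcv , a) ∷_) (dualW-involutive u)

  mutual-prefix : ∀ {xs ys us vs : List A} → xs ≡ ys ++ us → ys ≡ xs ++ vs → us ≡ [] × vs ≡ []
  mutual-prefix {xs} {ys} {us} {vs} xs≡ ys≡ = ++-conicalʳ vs us vs++us≡[] , ++-conicalˡ vs us vs++us≡[]
    where
      vs++us≡[] : vs ++ us ≡ []
      vs++us≡[] = ++-identityʳ-unique xs (trans xs≡ (trans (cong (_++ us) ys≡) (++-assoc xs vs us)))

snd≢rcv : snd ≢ rcv
snd≢rcv ()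

Ahead : ∀ {R A : Set} → List (Act R A) → List (Act R A) → Set
Ahead w v = (∃ λ z → received ⌊ w ⌋ ≡ received ⌊ v ⌋ ++ z) × (∃ λ z → sent ⌊ v ⌋ ≡ sent ⌊ w ⌋ ++ z)

module _ {R A : Set} {M : CFSM R A} where

  path-snoc : ∀ {q w q₁ l q₂} → Path M q w q₁ → (q₁ , l , q₂) ∈ δ M → Path M q (w ++ [ l ]) q₂
  path-snoc [] t = t ∷ []
  path-snoc (t ∷ p) t' = t ∷ path-snoc p t'

  path-split : ∀ {q q₂ w} → Path M q w q₂ → ∀ (u₁ u₂ : List (Dir × A)) → ⌊ w ⌋ ≡ u₁ ++ u₂ →
    ∃ λ q₁ → ∃ λ w₁ → ∃ λ w₂ → Path M q w₁ q₁ × Path M q₁ w₂ q₂ × ⌊ w₁ ⌋ ≡ u₁ × ⌊ w₂ ⌋ ≡ u₂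
  path-split p [] u₂ e = _ , [] , _ , [] , p , refl , e
  path-split [] (_ ∷ _) u₂ ()
  path-split (t ∷ p) (_ ∷ u₁) u₂ e with path-split p u₁ u₂ (∷-injectiveʳ e)
  ... | q₁ , w₁ , w₂ , p₁ , p₂ , e₁ , e₂ = q₁ , _ ∷ w₁ , w₂ , t ∷ p₁ , p₂ , cong₂ _∷_ (∷-injectiveˡ e) e₁ , e₂

  silent-path : ∀ {q w q'} → Path M q w q' → received ⌊ w ⌋ ≡ [] → sent ⌊ w ⌋ ≡ [] → q ≡ q'
  silent-path [] _ _ = refl
  silent-path (_∷_ {l = act _ _ snd _} t p) _ ()
  silent-path (_∷_ {l = act _ _ rcv _} t p) () _

  step-det : QEDet M → ∀ {q l l' q' q''} → (q , l , q') ∈ δ M → (q , l' , q'') ∈ δ M →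
             erase l ≡ erase l' → q' ≡ q''
  step-det (det? , det!) {l = act _ _ snd _} {act _ _ snd _} t t' refl = det! t t'
  step-det (det? , det!) {l = act _ _ rcv _} {act _ _ rcv _} t t' refl = det? t t'
  step-det _ {l = act _ _ snd _} {act _ _ rcv _} t t' ()
  step-det _ {l = act _ _ rcv _} {act _ _ snd _} t t' ()

  path-det : QEDet M → ∀ {q w w' q₁ q₂} → Path M q w q₁ → Path M q w' q₂ → ⌊ w ⌋ ≡ ⌊ w' ⌋ → q₁ ≡ q₂
  path-det D [] [] e = refl
  path-det D (t ∷ p) (t' ∷ p') e with step-det D t t' (∷-injectiveˡ e)
  ... | refl = path-det D p p' (∷-injectiveʳ e)

  same-direction : NoMixed M → ∀ {q l q' l' q''} → (q , l , q') ∈ δ M → (q , l' , q'') ∈ δ M →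
                   dir l ≡ dir l'
  same-direction NM {l = act _ _ snd _} {l' = act _ _ snd _} t t' = refl
  same-direction NM {l = act _ _ rcv _} {l' = act _ _ rcv _} t t' = refl
  same-direction NM {q} {l = act _ _ snd _} {l' = act _ _ rcv _} t t' =
    ⊥-elim (NM q ((λ F → F _ (_ , t)) , (λ S → snd≢rcv (sym (proj₂ S _ (_ , t')))) ,
                  (λ R → snd≢rcv (proj₂ R _ (_ , t)))))
  same-direction NM {q} {l = act _ _ rcv _} {l' = act _ _ snd _} t t' =
    ⊥-elim (NM q ((λ F → F _ (_ , t)) , (λ S → snd≢rcv (sym (proj₂ S _ (_ , t)))) ,
                  (λ R → snd≢rcv (proj₂ R _ (_ , t')))))

  first-agree : NoMixed M → ∀ {q l q' l' q'' w v} → (q , l , q') ∈ δ M → (q , l' , q'') ∈ δ M →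
                Ahead (l ∷ w) (l' ∷ v) → erase l ≡ erase l' × Ahead w v
  first-agree NM {l = act _ _ snd a} {l' = act _ _ snd a'} t t' (rw , z , e) =
    cong (snd ,_) (sym (∷-injectiveˡ e)) , rw , z , ∷-injectiveʳ e
  first-agree NM {l = act _ _ rcv a} {l' = act _ _ rcv a'} t t' ((z , e) , sv) =
    cong (rcv ,_) (∷-injectiveˡ e) , (z , ∷-injectiveʳ e) , sv
  first-agree NM {l = act _ _ snd _} {l' = act _ _ rcv _} t t' _ with same-direction NM t t'
  ... | ()
  first-agree NM {l = act _ _ rcv _} {l' = act _ _ snd _} t t' _ with same-direction NM t t'
  ... | ()

  comparable : NoMixed M → QEDet M → ∀ {q q₁ q₂ w v} → Path M q w q₁ → Path M q v q₂ → Ahead w v →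
    (∃ λ v₂ → Path M q₁ v₂ q₂ × ⌊ v ⌋ ≡ ⌊ w ⌋ ++ ⌊ v₂ ⌋) ⊎ (∃ λ w₂ → Path M q₂ w₂ q₁ × ⌊ w ⌋ ≡ ⌊ v ⌋ ++ ⌊ w₂ ⌋)
  comparable NM D [] p' _ = inj₁ (_ , p' , refl)
  comparable NM D (t ∷ p) [] _ = inj₂ (_ , t ∷ p , refl)
  comparable NM D (t ∷ p) (t' ∷ p') ahead with first-agree NM t t' ahead
  ... | e , ahead' with step-det D t t' e
  ... | refl with comparable NM D p p' ahead'
  ... | inj₁ (v₂ , pv , ev) = inj₁ (v₂ , pv , cong₂ _∷_ (sym e) ev)
  ... | inj₂ (w₂ , pw , ew) = inj₂ (w₂ , pw , cong₂ _∷_ e ew)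

compatible-sym : ∀ {R₁ R₂ A : Set} {M : CFSM R₁ A} {N : CFSM R₂ A} → Compatible M N → Compatible N M
compatible-sym {N = N} (M⊆N , N⊆M , nmM , nmN , detM , detN) =
  (λ u x → N⊆M (dualW u) (subst (InLnC N) (sym (dualW-involutive u)) x)) ,
  (λ u x → subst (InLnC N) (dualW-involutive u) (M⊆N (dualW u) x)) ,
  nmN , nmM , detN , detM

module Interface {R₁ R₂ A : Set} (M : CFSM R₁ A) (N : CFSM R₂ A) (C : Compatible M N) where

  private
    nmM : NoMixed M
    nmM = proj₁ (proj₂ (proj₂ C))

    detM : QEDet M
    detM = proj₁ (proj₂ (proj₂ (proj₂ (proj₂ C))))

    detN : QEDet N
    detN = proj₂ (proj₂ (proj₂ (proj₂ (proj₂ C))))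

  dual-run : ∀ {ũ qK} → Path N (q0 N) ũ qK →
             ∃ λ ṽ → ∃ λ qv → Path M (q0 M) ṽ qv × ⌊ ṽ ⌋ ≡ dualW ⌊ ũ ⌋
  dual-run {ũ} {qK} pu with proj₁ (proj₂ C) (dualW ⌊ ũ ⌋) (ũ , (qK , pu) , sym (dualW-involutive ⌊ ũ ⌋))
  ... | ṽ , (qv , pv) , e = ṽ , qv , pv , e

  dual-step : ∀ {ṽ qv l m ũ qK} → Path M (q0 M) ṽ qv → (qv , l , m) ∈ δ M → ⌊ ṽ ⌋ ≡ dualW ⌊ ũ ⌋ →
              Path N (q0 N) ũ qK → ∃ λ l' → ∃ λ m' → (qK , l' , m') ∈ δ N × dir l' ≡ dual (dir l)
  dual-step {ṽ} {qv} {l} {m} {ũ} {qK} pv t ev pu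
    with proj₁ C ⌊ ṽ ++ [ l ] ⌋ (ṽ ++ [ l ] , (m , path-snoc pv t) , refl)
  ... | ũ' , (_ , pu') , eu' with path-split pu' ⌊ ũ ⌋ [ (dual (dir l) , msg l) ] (trans eu' extended)
    where
      open ≡-Reasoning
      extended : dualW ⌊ ṽ ++ [ l ] ⌋ ≡ ⌊ ũ ⌋ ++ [ (dual (dir l) , msg l) ]
      extended = begin
        dualW ⌊ ṽ ++ [ l ] ⌋                     ≡⟨ cong dualW (map-++ erase ṽ [ l ]) ⟩
        dualW (⌊ ṽ ⌋ ++ [ erase l ])             ≡⟨ map-++ _ ⌊ ṽ ⌋ [ erase l ] ⟩
        dualW ⌊ ṽ ⌋ ++ [ (dual (dir l) , msg l) ] ≡⟨ cong (λ u → dualW u ++ _) ev ⟩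
        dualW (dualW ⌊ ũ ⌋) ++ _                  ≡⟨ cong (_++ _) (dualW-involutive ⌊ ũ ⌋) ⟩
        ⌊ ũ ⌋ ++ [ (dual (dir l) , msg l) ]      ∎
  ... | _ , _ , l' ∷ [] , p₁ , t' ∷ [] , e₁ , e₂ with path-det detN p₁ pu e₁
  ... | refl = l' , _ , t' , cong proj₁ (∷-injectiveˡ e₂)

  -- The situation at the interface: M has run w̃ to qH, N has run ũ to qK, and the messages
  -- M has received but N has not yet sent on (toN), resp. the converse (toM), are in transit.
  module InTransit {w̃ ũ qH qK} (pw : Path M (q0 M) w̃ qH) (pu : Path N (q0 N) ũ qK) (toN toM : List A)
                   (eH : received ⌊ w̃ ⌋ ≡ sent ⌊ ũ ⌋ ++ toN) (eK : received ⌊ ũ ⌋ ≡ sent ⌊ w̃ ⌋ ++ toM) where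

    private
      ṽ : List (Act R₁ A)
      ṽ = proj₁ (dual-run pu)

      qv : State M
      qv = proj₁ (proj₂ (dual-run pu))

      pv : Path M (q0 M) ṽ qv
      pv = proj₁ (proj₂ (proj₂ (dual-run pu)))

      ev : ⌊ ṽ ⌋ ≡ dualW ⌊ ũ ⌋
      ev = proj₂ (proj₂ (proj₂ (dual-run pu)))

      received-ṽ : received ⌊ ṽ ⌋ ≡ sent ⌊ ũ ⌋
      received-ṽ = trans (cong received ev) (received-dual ⌊ ũ ⌋)

      sent-ṽ : sent ⌊ ṽ ⌋ ≡ received ⌊ ũ ⌋
      sent-ṽ = trans (cong sent ev) (sent-dual ⌊ ũ ⌋)

      received-ahead : ∃ λ z → received ⌊ w̃ ⌋ ≡ received ⌊ ṽ ⌋ ++ z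
      received-ahead = toN , trans eH (cong (_++ toN) (sym received-ṽ))

      sent-ahead : ∃ λ z → sent ⌊ ṽ ⌋ ≡ sent ⌊ w̃ ⌋ ++ z
      sent-ahead = toM , trans sent-ṽ eK

    alignment : (∃ λ v₂ → Path M qH v₂ qv × received ⌊ v₂ ⌋ ≡ [] × sent ⌊ v₂ ⌋ ≡ toM × toN ≡ [])
              ⊎ (∃ λ w₂ → Path M qv w₂ qH × sent ⌊ w₂ ⌋ ≡ [] × received ⌊ w₂ ⌋ ≡ toN × toM ≡ [])
    alignment with comparable nmM detM pw pv (received-ahead , sent-ahead)
    ... | inj₁ (v₂ , pv₂ , e) =
      let toN≡[] , r≡[] = mutual-prefix (proj₂ received-ahead)
                            (trans (cong received e) (received-++ ⌊ w̃ ⌋ ⌊ v₂ ⌋))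
      in inj₁ (v₂ , pv₂ , r≡[] ,
               ++-cancelˡ (sent ⌊ w̃ ⌋) (sent ⌊ v₂ ⌋) toM
                 (trans (sym (trans (cong sent e) (sent-++ ⌊ w̃ ⌋ ⌊ v₂ ⌋))) (proj₂ sent-ahead)) ,
               toN≡[])
    ... | inj₂ (w₂ , pw₂ , e) =
      let toM≡[] , s≡[] = mutual-prefix (proj₂ sent-ahead)
                            (trans (cong sent e) (sent-++ ⌊ ṽ ⌋ ⌊ w₂ ⌋))
      in inj₂ (w₂ , pw₂ , s≡[] ,
               ++-cancelˡ (received ⌊ ṽ ⌋) (received ⌊ w₂ ⌋) toN
                 (trans (sym (trans (cong received e) (received-++ ⌊ ṽ ⌋ ⌊ w₂ ⌋))) (proj₂ received-ahead)) ,
               toM≡[])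

    synchronised : toN ≡ [] → toM ≡ [] → qv ≡ qH
    synchronised toN≡[] toM≡[] with alignment
    ... | inj₁ (_ , p , r≡[] , s≡toM , _) = sym (silent-path p r≡[] (trans s≡toM toM≡[]))
    ... | inj₂ (_ , p , s≡[] , r≡toN , _) = silent-path p (trans r≡toN toN≡[]) s≡[]

    not-both-sending : toN ≡ [] → toM ≡ [] → Sending M qH → Sending N qK → ⊥
    not-both-sending toN≡[] toM≡[] SM (_ , SN) with subst (Sending M) (sym (synchronised toN≡[] toM≡[])) SM
    ... | nonfinal , sends = nonfinal (λ l (_ , t) → dualised t (sends l (_ , t)))
      where
        dualised : ∀ {l m} → (qv , l , m) ∈ δ M → dir l ≡ snd → ⊥
        dualised t d with dual-step pv t ev pu
        ... | l' , m' , t' , d' = snd≢rcv (trans (sym (SN l' (m' , t'))) (trans d' (cong dual d)))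

    partner-not-final : toN ≢ [] → Final N qK → ⊥
    partner-not-final toN≢[] F with alignment
    ... | inj₁ (_ , _ , _ , _ , toN≡[]) = toN≢[] toN≡[]
    ... | inj₂ (_ , [] , _ , r≡toN , _) = toN≢[] (sym r≡toN)
    ... | inj₂ (_ , t ∷ _ , _) with dual-step pv t ev pu
    ... | l' , m' , t' , _ = F l' (m' , t')

    head-sendable : ∀ {c cs} → toM ≡ c ∷ cs → Sending M qH →
                    ∃ λ l → ∃ λ q' → (qH , l , q') ∈ δ M × dir l ≡ snd × msg l ≡ c
    head-sendable toM≡ SM with alignment
    ... | inj₂ (_ , _ , _ , _ , toM≡[]) with trans (sym toM≡) toM≡[]
    ... | ()
    head-sendable toM≡ SM | inj₁ (_ , [] , _ , s≡toM , _) with trans s≡toM toM≡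
    ... | ()
    head-sendable toM≡ SM | inj₁ (_ , _∷_ {l = act s r snd a} t _ , _ , s≡toM , _) =
      act s r snd a , _ , t , refl , ∷-injectiveˡ (trans s≡toM toM≡)
    head-sendable toM≡ SM | inj₁ (_ , _∷_ {l = act s r rcv a} t _ , _) with proj₂ SM _ (_ , t)
    ... | ()

module Relabel {R R' A : Set} (f : R → R') (M : CFSM R A) where

  M' : CFSM R' A
  M' = liftCFSM f M

  lift-trans : ∀ {u l v} → (u , l , v) ∈ δ M → (u , mapAct f l , v) ∈ δ M'
  lift-trans t = ∈-map⁺ _ t

  unlift-trans : ∀ {u l v} → (u , l , v) ∈ δ M' → ∃ λ l₀ → (u , l₀ , v) ∈ δ M × l ≡ mapAct f l₀
  unlift-trans t with ∈-map⁻ _ t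
  ... | (_ , act s r d a , _) , t₀ , refl = act s r d a , t₀ , refl

  final-unlift : ∀ {u} → Final M' u → Final M u
  final-unlift F l (v , t) = F _ (v , lift-trans t)

  final-lift : ∀ {u} → Final M u → Final M' u
  final-lift F l (v , t) = F _ (v , proj₁ (proj₂ (unlift-trans t)))

  dir-unlift : ∀ {d u} → IsDir d M' u → IsDir d M u
  dir-unlift (nf , D) = (λ F → nf (final-lift F)) , λ { (act s r d a) (v , t) → D _ (v , lift-trans t) }

  dir-lift : ∀ {d u} → IsDir d M u → IsDir d M' u
  dir-lift {d} {u} (nf , D) = (λ F → nf (final-unlift F)) , λ l (v , t) → same-dir (unlift-trans t)
    where
      same-dir : ∀ {l v} → (∃ λ l₀ → (u , l₀ , v) ∈ δ M × l ≡ mapAct f l₀) → dir l ≡ d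
      same-dir (act s r d a , t₀ , refl) = D _ (_ , t₀)

  path-unlift : ∀ {q w q'} → Path M' q w q' → ∃ λ w₀ → Path M q w₀ q' × ⌊ w ⌋ ≡ ⌊ w₀ ⌋
  path-unlift [] = [] , [] , refl
  path-unlift (t ∷ p) with unlift-trans t | path-unlift p
  ... | act s r d a , t₀ , refl | w₀ , p₀ , e = _ ∷ w₀ , t₀ ∷ p₀ , cong ((d , a) ∷_) e

  path-lift : ∀ {q w₀ q'} → Path M q w₀ q' → ∃ λ w → Path M' q w q' × ⌊ w ⌋ ≡ ⌊ w₀ ⌋
  path-lift [] = [] , [] , refl
  path-lift (_∷_ {l = act s r d a} t p) with path-lift p
  ... | w , p' , e = _ , lift-trans t ∷ p' , cong ((d , a) ∷_) e

  language-unlift : ∀ {u} → InLnC M' u → InLnC M u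
  language-unlift (w , (q , p) , e) with path-unlift p
  ... | w₀ , p₀ , e₀ = w₀ , (q , p₀) , trans (sym e₀) e

  language-lift : ∀ {u} → InLnC M u → InLnC M' u
  language-lift (w₀ , (q , p) , e) with path-lift p
  ... | w , p' , e' = w , (q , p') , trans e' e

  nomixed-lift : NoMixed M → NoMixed M'
  nomixed-lift nm q (nf , ns , nr) =
    nm q ((λ F → nf (final-lift F)) , (λ S → ns (dir-lift S)) , (λ R → nr (dir-lift R)))

  det-lift : ∀ {d} → Det d M → Det d M'
  det-lift D t t' with unlift-trans t | unlift-trans t'
  ... | act _ _ _ _ , t₀ , refl | act _ _ _ _ , t₀' , refl = D t₀ t₀'

-- Two machines with the same erased language, where the second inherits the absence of mixed
-- states and determinism from the first; compatibility only depends on this behaviour.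
SameBehaviour : ∀ {R R' A : Set} → CFSM R A → CFSM R' A → Set
SameBehaviour X Y = (∀ u → InLnC X u → InLnC Y u) × (∀ u → InLnC Y u → InLnC X u) ×
                    (NoMixed X → NoMixed Y) × (QEDet X → QEDet Y)

same-refl : ∀ {R A : Set} (X : CFSM R A) → SameBehaviour X X
same-refl X = (λ u x → x) , (λ u x → x) , (λ nm → nm) , (λ d → d)

same-trans : ∀ {R R' R'' A : Set} {X : CFSM R A} {Y : CFSM R' A} {Z : CFSM R'' A} →
             SameBehaviour X Y → SameBehaviour Y Z → SameBehaviour X Z
same-trans (X⊆Y , Y⊆X , nmXY , detXY) (Y⊆Z , Z⊆Y , nmYZ , detYZ) =
  (λ u x → Y⊆Z u (X⊆Y u x)) , (λ u z → Y⊆X u (Z⊆Y u z)) , (λ nm → nmYZ (nmXY nm)) , (λ d → detYZ (detXY d))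

relabel-same : ∀ {R R' A : Set} (f : R → R') (X : CFSM R A) → SameBehaviour X (liftCFSM f X)
relabel-same f X = (λ u → language-lift) , (λ u → language-unlift) , nomixed-lift ,
                   (λ { (det? , det!) → det-lift det? , det-lift det! })
  where open Relabel f X

compatible-resp : ∀ {R₁ R₂ R₁' R₂' A : Set} {X : CFSM R₁ A} {Y : CFSM R₂ A} {X' : CFSM R₁' A} {Y' : CFSM R₂' A} →
                  SameBehaviour X X' → SameBehaviour Y Y' → Compatible X Y → Compatible X' Y'
compatible-resp (X⊆X' , X'⊆X , nmX , detX) (Y⊆Y' , Y'⊆Y , nmY , detY) (X⊆Y , Y⊆X , nmx , nmy , dx , dy) =
  (λ u x → Y⊆Y' _ (X⊆Y u (X'⊆X u x))) , (λ u y → X⊆X' u (Y⊆X u (Y'⊆Y _ y))) , nmX nmx , nmY nmy , detX dx , detY dy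

module Gateway {R R' A : Set} (f : R → R') (_≟_ : DecidableEquality R) (H : R) (K' : R') {Q : Set} where

  gw : (ts : List (Trans Q R A)) → List (Trans (Q ⊎ Fin (length ts)) R' A)
  gw = gwTrans f _≟_ H K'

  data GwEdge (ts : List (Trans Q R A)) : Q ⊎ Fin (length ts) → Act R' A → Q ⊎ Fin (length ts) → Set where
    send-in  : ∀ i {q r a q'} → lookup ts i ≡ (q , act H r snd a , q') →
               GwEdge ts (inj₁ q) (act K' (f H) rcv a) (inj₂ i)
    send-out : ∀ i {q r a q'} → lookup ts i ≡ (q , act H r snd a , q') →
               GwEdge ts (inj₂ i) (act (f H) (f r) snd a) (inj₁ q')
    recv-in  : ∀ i {q s a q'} → lookup ts i ≡ (q , act s H rcv a , q') →
               GwEdge ts (inj₁ q) (act (f s) (f H) rcv a) (inj₂ i)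
    recv-out : ∀ i {q s a q'} → lookup ts i ≡ (q , act s H rcv a , q') →
               GwEdge ts (inj₂ i) (act (f H) K' snd a) (inj₁ q')

  private
    edge-head : ∀ {ts} t {x l y} → (x , l , y) ∈ gwStep f _≟_ H K' t zero → GwEdge (t ∷ ts) x l y
    edge-head (q , act s r snd a , q') m with s ≟ H
    edge-head (q , act s r snd a , q') (here refl) | yes refl = send-in zero refl
    edge-head (q , act s r snd a , q') (there (here refl)) | yes refl = send-out zero refl
    edge-head (q , act s r rcv a , q') m with r ≟ H
    edge-head (q , act s r rcv a , q') (here refl) | yes refl = recv-in zero refl
    edge-head (q , act s r rcv a , q') (there (here refl)) | yes refl = recv-out zero refl

    edge-shift : ∀ {t ts x l y} → GwEdge ts x l y →
      let (x' , _ , y') = shiftT f _≟_ H K' (x , l , y) in GwEdge (t ∷ ts) x' l y'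
    edge-shift (send-in i e) = send-in (suc i) e
    edge-shift (send-out i e) = send-out (suc i) e
    edge-shift (recv-in i e) = recv-in (suc i) e
    edge-shift (recv-out i e) = recv-out (suc i) e

    later : ∀ {t ts x} → x ∈ gw ts → shiftT f _≟_ H K' x ∈ gw (t ∷ ts)
    later {t} m = ∈-++⁺ʳ (gwStep f _≟_ H K' t zero) (∈-map⁺ _ m)

  edge-sound : ∀ {ts x l y} → (x , l , y) ∈ gw ts → GwEdge ts x l y
  edge-sound {t ∷ ts} m with ∈-++⁻ (gwStep f _≟_ H K' t zero) m
  ... | inj₁ m' = edge-head t m'
  ... | inj₂ m' with ∈-map⁻ (shiftT f _≟_ H K') m'
  ... | (_ , _ , _) , m'' , refl = edge-shift (edge-sound m'')

  edge-complete : ∀ {ts x l y} → GwEdge ts x l y → (x , l , y) ∈ gw ts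
  edge-complete {t ∷ ts} (send-in zero refl) with H ≟ H
  ... | yes _ = here refl
  ... | no H≢H = ⊥-elim (H≢H refl)
  edge-complete {t ∷ ts} (send-out zero refl) with H ≟ H
  ... | yes _ = there (here refl)
  ... | no H≢H = ⊥-elim (H≢H refl)
  edge-complete {t ∷ ts} (recv-in zero refl) with H ≟ H
  ... | yes _ = here refl
  ... | no H≢H = ⊥-elim (H≢H refl)
  edge-complete {t ∷ ts} (recv-out zero refl) with H ≟ H
  ... | yes _ = there (here refl)
  ... | no H≢H = ⊥-elim (H≢H refl)
  edge-complete {t ∷ ts} (send-in (suc i) e) = later {t} {ts} (edge-complete {ts} (send-in i e))
  edge-complete {t ∷ ts} (send-out (suc i) e) = later {t} {ts} (edge-complete {ts} (send-out i e))
  edge-complete {t ∷ ts} (recv-in (suc i) e) = later {t} {ts} (edge-complete {ts} (recv-in i e))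
  edge-complete {t ∷ ts} (recv-out (suc i) e) = later {t} {ts} (edge-complete {ts} (recv-out i e))

ActsAs : ∀ {R A : Set} → R → CFSM R A → Set
ActsAs H M = ∀ {q l q'} → (q , l , q') ∈ δ M → (dir l ≡ snd → from l ≡ H) × (dir l ≡ rcv → to l ≡ H)

module GatewayOf {R R' A : Set} (f : R → R') (_≟_ : DecidableEquality R) (H : R) (K' : R')
                 (M : CFSM R A) (own : ActsAs H M) where

  open Gateway {A = A} f _≟_ H K' {State M} public

  G : CFSM R' A
  G = gateway f _≟_ H K' M

  lookup-∈ : ∀ {i t} → lookup (δ M) i ≡ t → t ∈ δ M
  lookup-∈ {i} e = subst (_∈ δ M) e (∈-lookup i)

  private
    indexed : ∀ {t} → t ∈ δ M → ∃ λ i → lookup (δ M) i ≡ t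
    indexed t = index t , sym (lookup-index t)

  forward-send : ∀ {q s r a q'} → (q , act s r snd a , q') ∈ δ M →
                 ∃ λ i → (inj₁ q , act K' (f H) rcv a , inj₂ i) ∈ δ G
  forward-send t with indexed t | proj₁ (own t) refl
  ... | i , e | refl = i , edge-complete {δ M} (send-in i e)

  forward-recv : ∀ {q s a q'} → (q , act s H rcv a , q') ∈ δ M →
                 ∃ λ i → (inj₁ q , act (f s) (f H) rcv a , inj₂ i) ∈ δ G
  forward-recv t with indexed t
  ... | i , e = i , edge-complete {δ M} (recv-in i e)

  intermediate-sends : ∀ {i l y} → (inj₂ i , l , y) ∈ δ G → dir l ≡ snd
  intermediate-sends t with edge-sound {δ M} t
  ... | send-out _ _ = refl
  ... | recv-out _ _ = refl

  intermediate-moves : ∀ i → ∃ λ l → ∃ λ y → (inj₂ i , l , y) ∈ δ G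
  intermediate-moves i with lookup (δ M) i in e
  ... | (q , act s r snd a , q') with proj₁ (own (lookup-∈ e)) refl
  ...   | refl = _ , _ , edge-complete {δ M} (send-out i e)
  intermediate-moves i | (q , act s r rcv a , q') with proj₂ (own (lookup-∈ e)) refl
  ...   | refl = _ , _ , edge-complete {δ M} (recv-out i e)

  final-gateway : ∀ {q} → Final G (inj₁ q) → Final M q
  final-gateway F (act s r snd a) (_ , t) with forward-send t
  ... | _ , t' = F _ (_ , t')
  final-gateway F (act s r rcv a) (_ , t) with proj₂ (own t) refl
  ... | refl with forward-recv t
  ... | _ , t' = F _ (_ , t')

  final-original : ∀ {q} → Final M q → Final G (inj₁ q)
  final-original F l (_ , t) with edge-sound {δ M} t
  ... | send-in _ e = F _ (_ , lookup-∈ e)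
  ... | recv-in _ e = F _ (_ , lookup-∈ e)

  receiving-state : ∀ g → Receiving G g → ∃ λ q → g ≡ inj₁ q × ¬ Final M q
  receiving-state (inj₁ q) (nf , _) = q , refl , λ F → nf (final-original F)
  receiving-state (inj₂ i) (nf , D) = ⊥-elim (nf λ l (_ , t) → snd≢rcv (trans (sym (intermediate-sends t)) (D l (_ , t))))

  final-state : ∀ g → Final G g → ∃ λ q → g ≡ inj₁ q × Final M q
  final-state (inj₁ q) F = q , refl , final-gateway F
  final-state (inj₂ i) F = ⊥-elim (F _ (proj₂ (intermediate-moves i)))

module _ {P : FinSet} {A : Set} {S : System P A} where

  _≈C_ : Config S → Config S → Set
  c ≈C c' = (∀ p → st c' p ≡ st c p) × (∀ x y → ch c' x y ≡ ch c x y)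

  step-resp : ∀ {c c₁ c₂} → Step c c₁ → c₁ ≈C c₂ → Step c c₂
  step-resp (send p s r a q' t sp st≡ ch≡ (fs , fc)) (es , ec) =
    send p s r a q' t sp (trans (es p) st≡) (trans (ec s r) ch≡)
      ((λ p' ne → trans (es p') (fs p' ne)) , (λ x y ne → trans (ec x y) (fc x y ne)))
  step-resp (recv p s r a q' t rp st≡ ch≡ (fs , fc)) (es , ec) =
    recv p s r a q' t rp (trans (es p) st≡) (trans ch≡ (cong (a ∷_) (sym (ec s r))))
      ((λ p' ne → trans (es p') (fs p' ne)) , (λ x y ne → trans (ec x y) (fc x y ne)))

  private
    star-resp : ∀ {c₀ c c'} → Star (Step {S = S}) c₀ c → c ≈C c' → Star (Step {S = S}) c₀ c' ⊎ c₀ ≈C c'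
    star-resp ε eq = inj₂ eq
    star-resp (s ◅ ss) eq with star-resp ss eq
    ... | inj₁ ss' = inj₁ (s ◅ ss')
    ... | inj₂ eq' = inj₁ (step-resp s eq' ◅ ε)

  reachable-resp : ∀ {c c'} → Reachable S c → c ≈C c' → Reachable S c'
  reachable-resp (c₀ , ini , ss) eq with star-resp ss eq
  ... | inj₁ ss' = c₀ , ini , ss'
  ... | inj₂ (es , ec) = _ , ((λ p → trans (es p) (proj₁ ini p)) , (λ x y → trans (ec x y) (proj₂ ini x y))) , ε

  reachable-step : ∀ {c c'} → Reachable S c → Step c c' → Reachable S c'
  reachable-step (c₀ , ini , ss) s = c₀ , ini , (ss ◅◅ (s ◅ ε))

  actor : ∀ {c c'} → Step {S = S} c c' → Carrier P
  actor (send p _ _ _ _ _ _ _ _ _) = p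
  actor (recv p _ _ _ _ _ _ _ _ _) = p

Unserved : ∀ {P A} {S : System P A} → Config S → Carrier P → Set
Unserved {P} {A} {S} c r = ∀ (s : Carrier P) (a : A) q' → (st c r , act s r rcv a , q') ∈ δ (machine S r) →
                           (ch c s r ≢ []) × ¬ (∃ λ w → ch c s r ≡ a ∷ w)

module _ {R A : Set} {X Y : CFSM R A} where

  transport-trans : (e : X ≡ Y) → ∀ {u l v} → (u , l , v) ∈ δ X → (subst State e u , l , subst State e v) ∈ δ Y
  transport-trans refl t = t

  transport-trans⁻ : (e : X ≡ Y) → ∀ {u l v} → (subst State e u , l , v) ∈ δ Y → (u , l , subst State (sym e) v) ∈ δ X
  transport-trans⁻ refl t = t

  transport-dir : (e : X ≡ Y) → ∀ {d u} → IsDir d X u → IsDir d Y (subst State e u)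
  transport-dir refl D = D

  transport-final : (e : X ≡ Y) → ∀ {u} → Final X u → Final Y (subst State e u)
  transport-final refl F = F

  transport-q0 : (e : X ≡ Y) → subst State e (q0 X) ≡ q0 Y
  transport-q0 refl = refl

-- S is a system over roles R into which the roles P of a system S₁ are embedded by ι, the
-- remaining roles (of the other side) by ι'. Every role p ≠ H of S₁ runs its own machine
-- (relabelled), while H runs the gateway of M = machine S₁ H towards the partner K' = ι' K₀.

module Side {A : Set} (R P Q : FinSet) (S : System R A) (S₁ : System P A)
  (ι : Carrier P → Carrier R) (ι' : Carrier Q → Carrier R)
  (ι-inj : ∀ {x y} → ι x ≡ ι y → x ≡ y) (ι'-inj : ∀ {x y} → ι' x ≡ ι' y → x ≡ y)
  (ι≢ι' : ∀ {x y} → ι x ≢ ι' y)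
  (split : ∀ z → (∃ λ x → z ≡ ι x) ⊎ (∃ λ y → z ≡ ι' y))
  (H : Carrier P) (K₀ : Carrier Q)
  (eH : machine S (ι H) ≡ gateway ι (decEq P) H (ι' K₀) (machine S₁ H))
  (eP : ∀ p → p ≢ H → machine S (ι p) ≡ liftCFSM ι (machine S₁ p))
  (WF₁ : WellFormed S₁)
  where

  M : CFSM (Carrier P) A
  M = machine S₁ H

  K' : Carrier R
  K' = ι' K₀

  open GatewayOf ι (decEq P) H K' M (λ t → proj₂ (WF₁ H t))

  gwState : Config S → State G
  gwState c = subst State eH (st c (ι H))

  toK fromK : Config S → List A
  toK c = ch c (ι H) K'
  fromK c = ch c K' (ι H)

  -- The state of M that S₁ observes in a gateway state: a send of M takes effect when the
  -- gateway passes the message on, a receive as soon as the gateway has received it.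
  visible-of : Trans (State M) (Carrier P) A → State M
  visible-of (q , act _ _ snd _ , q') = q
  visible-of (q , act _ _ rcv _ , q') = q'

  visible : State G → State M
  visible (inj₁ q) = q
  visible (inj₂ i) = visible-of (lookup (δ M) i)

  committed : State G → State M
  committed (inj₁ q) = q
  committed (inj₂ i) = proj₂ (proj₂ (lookup (δ M) i))

  -- The message received by the gateway from S₁ but not yet forwarded to K'.
  pending-of : Trans (State M) (Carrier P) A → List A
  pending-of (q , act _ _ snd _ , q') = []
  pending-of (q , act _ _ rcv a , q') = [ a ]

  pending : State G → List A
  pending (inj₁ q) = []
  pending (inj₂ i) = pending-of (lookup (δ M) i)

  project-state : Config S → (p : Carrier P) → Dec (p ≡ H) → State (machine S₁ p)
  project-state c p (yes refl) = visible (gwState c)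
  project-state c p (no p≢H) = subst State (eP p p≢H) (st c (ι p))

  project : Config S → Config S₁
  project c = record { st = λ p → project-state c p (decEq P p H) ; ch = λ x y → ch c (ι x) (ι y) }

  project-H : ∀ c → st (project c) H ≡ visible (gwState c)
  project-H c with decEq P H H
  ... | yes refl = refl
  ... | no H≢H = ⊥-elim (H≢H refl)

  project-other : ∀ c p (p≢H : p ≢ H) → st (project c) p ≡ subst State (eP p p≢H) (st c (ι p))
  project-other c p p≢H with decEq P p H
  ... | yes refl = ⊥-elim (p≢H refl)
  ... | no p≢H' = cong (λ e → subst State e (st c (ι p))) (uip (eP p p≢H') (eP p p≢H))

  project-initial : ∀ c → IsInitial c → IsInitial (project c)
  project-initial c (is , ic) = (λ p → initial-state p (decEq P p H)) , (λ x y → ic (ι x) (ι y))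
    where
      initial-state : ∀ p d → project-state c p d ≡ q0 (machine S₁ p)
      initial-state p (yes refl) = cong visible (trans (cong (subst State eH) (is (ι H))) (transport-q0 eH))
      initial-state p (no p≢H) = trans (cong (subst State (eP p p≢H)) (is (ι p))) (transport-q0 (eP p p≢H))

  project-unchanged : ∀ {c c' p s r} → Frame p s r c c' → ∀ x → ι x ≢ p → st (project c') x ≡ st (project c) x
  project-unchanged {c} {c'} (fs , _) x ιx≢p = unchanged (decEq P x H) (fs (ι x) ιx≢p)
    where
      unchanged : ∀ d → st c' (ι x) ≡ st c (ι x) → project-state c' x d ≡ project-state c x d
      unchanged (yes refl) e = cong (λ u → visible (subst State eH u)) e
      unchanged (no x≢H) e = cong (subst State (eP x x≢H)) e

  project-Frame : ∀ {c c' x s₀ r₀} → Frame (ι x) (ι s₀) (ι r₀) c c' → Frame x s₀ r₀ (project c) (project c')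
  project-Frame fr = (λ p ne → project-unchanged fr p (λ e → ne (ι-inj e))) ,
                     (λ x y ne → proj₂ fr (ι x) (ι y) (λ { (e₁ , e₂) → ne (ι-inj e₁ , ι-inj e₂) }))

  invisible : ∀ {c c' p s r} → Frame p s r c c' → st (project c') H ≡ st (project c) H →
              (∀ x → x ≢ H → ι x ≢ p) → (∀ x y → ¬ (ι x ≡ s × ι y ≡ r)) → project c ≈C project c'
  invisible {c} {c'} fr H-same others channels =
    (λ x → unchanged x (decEq P x H)) , (λ x y → proj₂ fr (ι x) (ι y) (channels x y))
    where
      unchanged : ∀ x → Dec (x ≡ H) → st (project c') x ≡ st (project c) x
      unchanged x (yes refl) = H-same
      unchanged x (no x≢H) = project-unchanged fr x (others x x≢H)

  Simulated : Config S → Config S → Set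
  Simulated c c' = (project c ≈C project c') ⊎ Step (project c) (project c')

  visible-orig : ∀ c {q} → gwState c ≡ inj₁ q → st (project c) H ≡ q
  visible-orig c eg = trans (project-H c) (cong visible eg)

  visible-fresh : ∀ c {i t} → gwState c ≡ inj₂ i → lookup (δ M) i ≡ t → st (project c) H ≡ visible-of t
  visible-fresh c eg e = trans (project-H c) (trans (cong visible eg) (cong visible-of e))

  simulate-other-send : ∀ {c c' x s r a q'} (x≢H : x ≢ H) → (st c (ι x) , act s r snd a , q') ∈ δ (machine S (ι x)) →
    s ≡ ι x → st c' (ι x) ≡ q' → ch c' s r ≡ ch c s r ++ [ a ] → Frame (ι x) s r c c' → Simulated c c'
  simulate-other-send {c} {c'} {x} x≢H t sp st≡ ch≡ fr
    with Relabel.unlift-trans ι (machine S₁ x) (transport-trans (eP x x≢H) t)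
  ... | act s₀ r₀ _ a₀ , t₀ , refl =
    inj₂ (send x s₀ r₀ a₀ _ (subst (λ u → (u , _ , _) ∈ _) (sym (project-other c x x≢H)) t₀)
           (ι-inj sp) (trans (project-other c' x x≢H) (cong _ st≡)) ch≡ (project-Frame fr))

  simulate-other-recv : ∀ {c c' x s r a q'} (x≢H : x ≢ H) → (st c (ι x) , act s r rcv a , q') ∈ δ (machine S (ι x)) →
    r ≡ ι x → st c' (ι x) ≡ q' → ch c s r ≡ a ∷ ch c' s r → Frame (ι x) s r c c' → Simulated c c'
  simulate-other-recv {c} {c'} {x} x≢H t rp st≡ ch≡ fr
    with Relabel.unlift-trans ι (machine S₁ x) (transport-trans (eP x x≢H) t)
  ... | act s₀ r₀ _ a₀ , t₀ , refl =
    inj₂ (recv x s₀ r₀ a₀ _ (subst (λ u → (u , _ , _) ∈ _) (sym (project-other c x x≢H)) t₀)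
           (ι-inj rp) (trans (project-other c' x x≢H) (cong _ st≡)) ch≡ (project-Frame fr))

  private
    others-untouched : ∀ x → x ≢ H → ι x ≢ ι H
    others-untouched x x≢H e = x≢H (ι-inj e)

  -- A send of H's gateway is a send of M in S₁, or invisible when it forwards to K'.
  simulate-gateway-send : ∀ {c c' s r a q'} → (st c (ι H) , act s r snd a , q') ∈ δ (machine S (ι H)) →
    st c' (ι H) ≡ q' → ch c' s r ≡ ch c s r ++ [ a ] → Frame (ι H) s r c c' → Simulated c c'
  simulate-gateway-send {c} {c'} t st≡ = by-edge refl (cong (subst State eH) st≡) (transport-trans eH t)
    where
      by-edge : ∀ {g g' s r a} → gwState c ≡ g → gwState c' ≡ g' → (g , act s r snd a , g') ∈ δ G →
                ch c' s r ≡ ch c s r ++ [ a ] → Frame (ι H) s r c c' → Simulated c c'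
      by-edge eg eg' t' with edge-sound {δ M} t'
      ... | send-out i e = λ ch≡ fr → inj₂ (send H H _ _ _
              (subst (λ u → (u , _ , _) ∈ δ M) (sym (visible-fresh c eg e)) (lookup-∈ e))
              refl (visible-orig c' eg') ch≡ (project-Frame fr))
      ... | recv-out i e = λ _ fr → inj₁ (invisible fr
              (trans (visible-orig c' eg') (sym (visible-fresh c eg e)))
              others-untouched (λ x y both → ι≢ι' (proj₂ both)))

  -- A receive of H's gateway is a receive of M in S₁, or invisible when it comes from K'.
  simulate-gateway-recv : ∀ {c c' s r a q'} → (st c (ι H) , act s r rcv a , q') ∈ δ (machine S (ι H)) →
    st c' (ι H) ≡ q' → ch c s r ≡ a ∷ ch c' s r → Frame (ι H) s r c c' → Simulated c c'
  simulate-gateway-recv {c} {c'} t st≡ = by-edge refl (cong (subst State eH) st≡) (transport-trans eH t)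
    where
      by-edge : ∀ {g g' s r a} → gwState c ≡ g → gwState c' ≡ g' → (g , act s r rcv a , g') ∈ δ G →
                ch c s r ≡ a ∷ ch c' s r → Frame (ι H) s r c c' → Simulated c c'
      by-edge eg eg' t' with edge-sound {δ M} t'
      ... | send-in i e = λ _ fr → inj₁ (invisible fr
              (trans (visible-fresh c' eg' e) (sym (visible-orig c eg)))
              others-untouched (λ x y both → ι≢ι' (proj₁ both)))
      ... | recv-in i e = λ ch≡ fr → inj₂ (recv H _ H _ _
              (subst (λ u → (u , _ , _) ∈ δ M) (sym (visible-orig c eg)) (lookup-∈ e))
              refl (visible-fresh c' eg' e) ch≡ (project-Frame fr))

  simulate : ∀ {c c'} → Step c c' → Simulated c c'
  simulate (send p s r a q' t sp st≡ ch≡ fr) with split p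
  ... | inj₂ (y , refl) = inj₁ (invisible fr (project-unchanged fr H ι≢ι') (λ x _ → ι≢ι')
                                  (λ x y both → ι≢ι' (trans (proj₁ both) sp)))
  ... | inj₁ (x , refl) with decEq P x H
  ... | yes refl = simulate-gateway-send t st≡ ch≡ fr
  ... | no x≢H = simulate-other-send x≢H t sp st≡ ch≡ fr
  simulate (recv p s r a q' t rp st≡ ch≡ fr) with split p
  ... | inj₂ (y , refl) = inj₁ (invisible fr (project-unchanged fr H ι≢ι') (λ x _ → ι≢ι')
                                  (λ x y both → ι≢ι' (trans (proj₂ both) rp)))
  ... | inj₁ (x , refl) with decEq P x H
  ... | yes refl = simulate-gateway-recv t st≡ ch≡ fr
  ... | no x≢H = simulate-other-recv x≢H t rp st≡ ch≡ fr

  project-reachable : ∀ {c} → Reachable S c → Reachable S₁ (project c)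
  project-reachable (c₀ , ini , steps) = go (project c₀ , project-initial c₀ ini , ε) steps
    where
      go : ∀ {c c'} → Reachable S₁ (project c) → Star (Step {S = S}) c c' → Reachable S₁ (project c')
      go r ε = r
      go r (s ◅ ss) with simulate s
      ... | inj₁ eq = go (reachable-resp r eq) ss
      ... | inj₂ s₁ = go (reachable-step r s₁) ss

  record Explains (c : Config S) (U : List (Dir × A)) (X : List A) (w̃ : List (Act (Carrier P) A)) : Set where
    constructor explains
    field
      run       : Path M (q0 M) w̃ (committed (gwState c))
      via-toK   : received ⌊ w̃ ⌋ ≡ sent U ++ (toK c ++ pending (gwState c))
      via-fromK : received U ≡ sent ⌊ w̃ ⌋ ++ (fromK c ++ X)

  explains-initial : ∀ c → IsInitial c → Explains c [] [] []
  explains-initial c (is , ic) =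
    explains (subst (Path M (q0 M) []) (cong committed (sym at-q0)) [])
             (sym (cong₂ _++_ (ic (ι H) K') (cong pending at-q0)))
             (sym (cong (_++ []) (ic K' (ι H))))
    where
      at-q0 : gwState c ≡ inj₁ (q0 M)
      at-q0 = trans (cong (subst State eH) (is (ι H))) (transport-q0 eH)

  explains-resp : ∀ {c c' U X X' w̃} → committed (gwState c') ≡ committed (gwState c) →
                  toK c' ++ pending (gwState c') ≡ toK c ++ pending (gwState c) → fromK c' ≡ fromK c →
                  X' ≡ X → Explains c U X w̃ → Explains c' U X' w̃
  explains-resp {U = U} {w̃ = w̃} ec et ef ex (explains pw e₁ e₂) =
    explains (subst (Path M _ w̃) (sym ec) pw) (trans e₁ (cong (sent U ++_) (sym et)))
             (trans e₂ (cong₂ (λ z x → sent ⌊ w̃ ⌋ ++ (z ++ x)) (sym ef) (sym ex)))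

  gwState-other-step : ∀ {c c'} (s : Step c c') → actor s ≢ ι H → gwState c' ≡ gwState c
  gwState-other-step (send _ _ _ _ _ _ _ _ _ (fs , _)) ne = cong (subst State eH) (fs (ι H) (λ e → ne (sym e)))
  gwState-other-step (recv _ _ _ _ _ _ _ _ _ (fs , _)) ne = cong (subst State eH) (fs (ι H) (λ e → ne (sym e)))

  interface-other-step : ∀ {c c'} (s : Step c c') x → actor s ≡ ι x → x ≢ H →
                         (toK c' ≡ toK c) × (fromK c' ≡ fromK c)
  interface-other-step (send _ _ _ _ _ _ sp _ _ (_ , fc)) x refl x≢H =
    fc (ι H) K' (λ both → x≢H (ι-inj (sym (trans (proj₁ both) sp)))) ,
    fc K' (ι H) (λ both → ι≢ι' (sym (trans (proj₁ both) sp)))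
  interface-other-step (recv _ _ _ _ _ _ rp _ _ (_ , fc)) x refl x≢H =
    fc (ι H) K' (λ both → ι≢ι' (sym (trans (proj₂ both) rp))) ,
    fc K' (ι H) (λ both → x≢H (ι-inj (sym (trans (proj₂ both) rp))))

  private
    received-snoc : ∀ (w : List (Act (Carrier P) A)) l → received ⌊ w ++ [ l ] ⌋ ≡ received ⌊ w ⌋ ++ received [ erase l ]
    received-snoc w l = trans (cong received (map-++ erase w [ l ])) (received-++ ⌊ w ⌋ _)

    sent-snoc : ∀ (w : List (Act (Carrier P) A)) l → sent ⌊ w ++ [ l ] ⌋ ≡ sent ⌊ w ⌋ ++ sent [ erase l ]
    sent-snoc w l = trans (cong sent (map-++ erase w [ l ])) (sent-++ ⌊ w ⌋ _)

    committed-fresh : ∀ c {i q l q'} → gwState c ≡ inj₂ i → lookup (δ M) i ≡ (q , l , q') → committed (gwState c) ≡ q'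
    committed-fresh c eg e = trans (cong committed eg) (cong (λ t → proj₂ (proj₂ t)) e)

    pending-fresh : ∀ c {i t} → gwState c ≡ inj₂ i → lookup (δ M) i ≡ t → pending (gwState c) ≡ pending-of t
    pending-fresh c eg e = trans (cong pending eg) (cong pending-of e)

    explains-extend : ∀ {c c' U X w̃ q l q' i} → Explains c U X w̃ → gwState c ≡ inj₁ q →
      lookup (δ M) i ≡ (q , l , q') → gwState c' ≡ inj₂ i →
      received ⌊ w̃ ++ [ l ] ⌋ ≡ sent U ++ (toK c' ++ pending (gwState c')) →
      received U ≡ sent ⌊ w̃ ++ [ l ] ⌋ ++ (fromK c' ++ X) → Explains c' U X (w̃ ++ [ l ])
    explains-extend {c' = c'} {w̃ = w̃} (explains pw _ _) eg e eg' e₁ e₂ =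
      explains (subst (Path M _ (w̃ ++ _)) (sym (committed-fresh c' eg' e))
                 (path-snoc (subst (Path M _ w̃) (cong committed eg) pw) (lookup-∈ e))) e₁ e₂

  explains-gateway-send : ∀ {c c' s r a q' U X w̃} → (st c (ι H) , act s r snd a , q') ∈ δ (machine S (ι H)) →
    st c' (ι H) ≡ q' → ch c' s r ≡ ch c s r ++ [ a ] → Frame (ι H) s r c c' →
    Explains c U X w̃ → ∃ λ w̃' → Explains c' U X w̃'
  explains-gateway-send {c} {c'} {U = U} {X} {w̃} t st≡ =
    by-edge refl (cong (subst State eH) st≡) (transport-trans eH t)
    where
      by-edge : ∀ {g g' s r a} → gwState c ≡ g → gwState c' ≡ g' → (g , act s r snd a , g') ∈ δ G →
                ch c' s r ≡ ch c s r ++ [ a ] → Frame (ι H) s r c c' →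
                Explains c U X w̃ → ∃ λ w̃' → Explains c' U X w̃'
      by-edge eg eg' t' with edge-sound {δ M} t'
      -- H passes a message of M on to S₁: the run already contains this send.
      ... | send-out i e = λ _ (_ , fc) ex → w̃ , explains-resp
              (trans (cong committed eg') (sym (committed-fresh c eg e)))
              (cong₂ _++_ (fc (ι H) K' (λ both → ι≢ι' (sym (proj₂ both))))
                          (trans (cong pending eg') (sym (pending-fresh c eg e))))
              (fc K' (ι H) (λ both → ι≢ι' (sym (proj₁ both)))) refl ex
      -- H forwards a received message to K': it moves from pending into the channel.
      ... | recv-out i {a = b} e = λ ch≡ (_ , fc) ex → w̃ , explains-resp
              (trans (cong committed eg') (sym (committed-fresh c eg e)))
              (begin
                toK c' ++ pending (gwState c') ≡⟨ cong (toK c' ++_) (cong pending eg') ⟩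
                toK c' ++ []                   ≡⟨ ++-identityʳ (toK c') ⟩
                toK c'                         ≡⟨ ch≡ ⟩
                toK c ++ [ b ]                 ≡⟨ cong (toK c ++_) (sym (pending-fresh c eg e)) ⟩
                toK c ++ pending (gwState c)   ∎)
              (fc K' (ι H) (λ both → ι≢ι' (sym (proj₁ both)))) refl ex
        where open ≡-Reasoning

  -- K' asks H to send b: the explaining run performs the send, and b leaves the channel from K'.
  explains-take-send : ∀ {c c' U X w̃ q r b q' i} → Explains c U X w̃ → gwState c ≡ inj₁ q →
    lookup (δ M) i ≡ (q , act H r snd b , q') → gwState c' ≡ inj₂ i →
    toK c' ≡ toK c → fromK c ≡ b ∷ fromK c' → Explains c' U X (w̃ ++ [ act H r snd b ])
  explains-take-send {c} {c'} {U} {X} {w̃} {r = r} {b} ex eg e eg' toK≡ fromK≡ =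
    explains-extend {c' = c'} ex eg e eg'
      (begin
        received ⌊ w̃ ++ [ l ] ⌋                  ≡⟨ trans (received-snoc w̃ l) (++-identityʳ _) ⟩
        received ⌊ w̃ ⌋                          ≡⟨ Explains.via-toK ex ⟩
        sent U ++ (toK c ++ pending (gwState c)) ≡⟨ cong (λ z → sent U ++ (toK c ++ z)) (cong pending eg) ⟩
        sent U ++ (toK c ++ [])                  ≡⟨ cong (λ z → sent U ++ (z ++ [])) (sym toK≡) ⟩
        sent U ++ (toK c' ++ [])                 ≡⟨ cong (λ z → sent U ++ (toK c' ++ z)) (sym (pending-fresh c' eg' e)) ⟩
        sent U ++ (toK c' ++ pending (gwState c')) ∎)
      (begin
        received U                               ≡⟨ Explains.via-fromK ex ⟩
        sent ⌊ w̃ ⌋ ++ (fromK c ++ X)             ≡⟨ cong (λ z → sent ⌊ w̃ ⌋ ++ (z ++ X)) fromK≡ ⟩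
        sent ⌊ w̃ ⌋ ++ ([ b ] ++ (fromK c' ++ X)) ≡⟨ sym (++-assoc (sent ⌊ w̃ ⌋) [ b ] _) ⟩
        (sent ⌊ w̃ ⌋ ++ [ b ]) ++ (fromK c' ++ X) ≡⟨ cong (_++ _) (sym (sent-snoc w̃ l)) ⟩
        sent ⌊ w̃ ++ [ l ] ⌋ ++ (fromK c' ++ X)   ∎)
    where
      open ≡-Reasoning
      l = act H r snd b

  -- H receives b from S₁: the explaining run performs the receive, and b becomes pending.
  explains-take-recv : ∀ {c c' U X w̃ q s b q' i} → Explains c U X w̃ → gwState c ≡ inj₁ q →
    lookup (δ M) i ≡ (q , act s H rcv b , q') → gwState c' ≡ inj₂ i →
    toK c' ≡ toK c → fromK c' ≡ fromK c → Explains c' U X (w̃ ++ [ act s H rcv b ])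
  explains-take-recv {c} {c'} {U} {X} {w̃} {s = s} {b} ex eg e eg' toK≡ fromK≡ =
    explains-extend {c' = c'} ex eg e eg'
      (begin
        received ⌊ w̃ ++ [ l ] ⌋                          ≡⟨ received-snoc w̃ l ⟩
        received ⌊ w̃ ⌋ ++ [ b ]                          ≡⟨ cong (_++ [ b ]) (Explains.via-toK ex) ⟩
        (sent U ++ (toK c ++ pending (gwState c))) ++ [ b ]
                                  ≡⟨ cong (λ z → (sent U ++ (toK c ++ z)) ++ [ b ]) (cong pending eg) ⟩
        (sent U ++ (toK c ++ [])) ++ [ b ]               ≡⟨ cong (λ z → (sent U ++ z) ++ [ b ]) (++-identityʳ (toK c)) ⟩
        (sent U ++ toK c) ++ [ b ]                       ≡⟨ ++-assoc (sent U) (toK c) [ b ] ⟩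
        sent U ++ (toK c ++ [ b ])                       ≡⟨ cong (λ z → sent U ++ (z ++ [ b ])) (sym toK≡) ⟩
        sent U ++ (toK c' ++ [ b ])   ≡⟨ cong (λ z → sent U ++ (toK c' ++ z)) (sym (pending-fresh c' eg' e)) ⟩
        sent U ++ (toK c' ++ pending (gwState c'))       ∎)
      (begin
        received U                             ≡⟨ Explains.via-fromK ex ⟩
        sent ⌊ w̃ ⌋ ++ (fromK c ++ X)           ≡⟨ cong (λ z → sent ⌊ w̃ ⌋ ++ (z ++ X)) (sym fromK≡) ⟩
        sent ⌊ w̃ ⌋ ++ (fromK c' ++ X)          ≡⟨ cong (_++ _) (sym (trans (sent-snoc w̃ l) (++-identityʳ _))) ⟩
        sent ⌊ w̃ ++ [ l ] ⌋ ++ (fromK c' ++ X) ∎)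
    where
      open ≡-Reasoning
      l = act s H rcv b

  explains-gateway-recv : ∀ {c c' s r a q' U X w̃} → (st c (ι H) , act s r rcv a , q') ∈ δ (machine S (ι H)) →
    st c' (ι H) ≡ q' → ch c s r ≡ a ∷ ch c' s r → Frame (ι H) s r c c' →
    Explains c U X w̃ → ∃ λ w̃' → Explains c' U X w̃'
  explains-gateway-recv {c} {c'} {U = U} {X} {w̃} t st≡ =
    by-edge refl (cong (subst State eH) st≡) (transport-trans eH t)
    where
      by-edge : ∀ {g g' s r a} → gwState c ≡ g → gwState c' ≡ g' → (g , act s r rcv a , g') ∈ δ G →
                ch c s r ≡ a ∷ ch c' s r → Frame (ι H) s r c c' →
                Explains c U X w̃ → ∃ λ w̃' → Explains c' U X w̃'
      by-edge eg eg' t' with edge-sound {δ M} t'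
      ... | send-in i e = λ ch≡ (_ , fc) ex →
        _ , explains-take-send {c' = c'} ex eg e eg' (fc (ι H) K' (λ both → ι≢ι' (proj₁ both))) ch≡
      ... | recv-in i e = λ _ (_ , fc) ex →
        _ , explains-take-recv {c' = c'} ex eg e eg' (fc (ι H) K' (λ both → ι≢ι' (sym (proj₂ both))))
                                                     (fc K' (ι H) (λ both → ι≢ι' (sym (proj₁ both))))

  explains-gateway-step : ∀ {c c'} (s : Step c c') → actor s ≡ ι H → ∀ {U X w̃} →
                          Explains c U X w̃ → ∃ λ w̃' → Explains c' U X w̃'
  explains-gateway-step (send _ _ _ _ _ t _ st≡ ch≡ fr) refl = explains-gateway-send t st≡ ch≡ fr
  explains-gateway-step (recv _ _ _ _ _ t _ st≡ ch≡ fr) refl = explains-gateway-recv t st≡ ch≡ fr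

  explains-own-step : ∀ {c c'} (s : Step c c') x → actor s ≡ ι x → ∀ {U X X' w̃} → X' ≡ X →
                      Explains c U X w̃ → ∃ λ w̃' → Explains c' U X' w̃'
  explains-own-step s x actor≡ X'≡X ex with decEq P x H
  ... | yes refl with explains-gateway-step s actor≡ ex
  ... | w̃' , ex' = w̃' , explains-resp refl refl refl X'≡X ex'
  explains-own-step {c} {c'} s x actor≡ {w̃ = w̃} X'≡X ex | no x≢H =
    w̃ , explains-resp (cong committed gw≡) (cong₂ _++_ (proj₁ channels≡) (cong pending gw≡)) (proj₂ channels≡) X'≡X ex
    where
      gw≡ : gwState c' ≡ gwState c
      gw≡ = gwState-other-step s (λ e → x≢H (ι-inj (trans (sym actor≡) e)))

      channels≡ : (toK c' ≡ toK c) × (fromK c' ≡ fromK c)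
      channels≡ = interface-other-step s x actor≡ x≢H

  gwState-across-step : ∀ {c c'} (s : Step c c') y → actor s ≡ ι' y → gwState c' ≡ gwState c
  gwState-across-step s y actor≡ = gwState-other-step s (λ e → ι≢ι' (trans (sym e) actor≡))

  CrossEmpty : Config S → Set
  CrossEmpty c = ∀ x y → ¬ (x ≡ H × y ≡ K₀) → ch c (ι x) (ι' y) ≡ []

  cross-initial : ∀ c → IsInitial c → CrossEmpty c
  cross-initial c (_ , ic) x y _ = ic (ι x) (ι' y)

  no-send-across : ∀ (c : Config S) {x y l q'} → ¬ (x ≡ H × y ≡ K₀) → (st c (ι x) , l , q') ∈ δ (machine S (ι x)) →
                   dir l ≡ snd → to l ≡ ι' y → ⊥
  no-send-across c {x} {y} not-iface t d e with decEq P x H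
  ... | yes refl = via-gateway (transport-trans eH t) d e
    where
      via-gateway : ∀ {g l g'} → (g , l , g') ∈ δ G → dir l ≡ snd → to l ≡ ι' y → ⊥
      via-gateway t' d e with edge-sound {δ M} t'
      ... | send-out _ _ = ι≢ι' e
      ... | recv-out _ _ = not-iface (refl , ι'-inj (sym e))
      via-gateway t' () e | send-in _ _
      via-gateway t' () e | recv-in _ _
  ... | no x≢H = ι≢ι' (trans (sym (cong to l≡)) e)
    where l≡ = proj₂ (proj₂ (Relabel.unlift-trans ι (machine S₁ x) (transport-trans (eP x x≢H) t)))

  cross-step : ∀ {c c'} → Step c c' → CrossEmpty c → CrossEmpty c'
  cross-step {c} (send p s r a q' t sp st≡ ch≡ (_ , fc)) empty x y not-iface
    with decEq R (ι x) s | decEq R (ι' y) r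
  ... | yes refl | yes refl with sp
  ... | refl = ⊥-elim (no-send-across c not-iface t refl refl)
  cross-step (send p s r a q' t sp st≡ ch≡ (_ , fc)) empty x y not-iface | yes _ | no r≢ =
    trans (fc _ _ (λ both → r≢ (proj₂ both))) (empty x y not-iface)
  cross-step (send p s r a q' t sp st≡ ch≡ (_ , fc)) empty x y not-iface | no s≢ | _ =
    trans (fc _ _ (λ both → s≢ (proj₁ both))) (empty x y not-iface)
  cross-step (recv p s r a q' t rp st≡ ch≡ (_ , fc)) empty x y not-iface
    with decEq R (ι x) s | decEq R (ι' y) r
  ... | yes refl | yes refl with trans (sym (empty x y not-iface)) ch≡
  ... | ()
  cross-step (recv p s r a q' t rp st≡ ch≡ (_ , fc)) empty x y not-iface | yes _ | no r≢ =
    trans (fc _ _ (λ both → r≢ (proj₂ both))) (empty x y not-iface)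
  cross-step (recv p s r a q' t rp st≡ ch≡ (_ , fc)) empty x y not-iface | no s≢ | _ =
    trans (fc _ _ (λ both → s≢ (proj₁ both))) (empty x y not-iface)

  private
    safe-projection : Safe S₁ → ∀ {c} → Reachable S c →
      ¬ Deadlock (project c) × ¬ OrphanMessage (project c) × ¬ UnspecifiedReception (project c)
    safe-projection safe r = safe _ (project-reachable r)

    gateway-from : ∀ c {q l v} → gwState c ≡ inj₁ q → (inj₁ q , l , v) ∈ δ G →
                   (st c (ι H) , l , subst State (sym eH) v) ∈ δ (machine S (ι H))
    gateway-from c eg t = transport-trans⁻ eH (subst (λ g → (g , _ , _) ∈ δ G) (sym eg) t)

  deadlock-interface : NoMixed M → Safe S₁ → ∀ c → Reachable S c → Deadlock c →
                       ∃ λ q → gwState c ≡ inj₁ q × ¬ ¬ Sending M q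
  deadlock-interface NM safe c r (empty , receiving)
    with receiving-state (gwState c) (transport-dir eH (receiving (ι H)))
  ... | q , eg , nonfinal = q , eg , λ ¬SM → NM q (nonfinal , ¬SM , λ RM →
          proj₁ (safe-projection safe r)
            ((λ x y x≢y → empty (ι x) (ι y) (λ e → x≢y (ι-inj e))) , (λ p → all-receiving RM p (decEq P p H))))
    where
      all-receiving : Receiving M q → ∀ p d → Receiving (machine S₁ p) (project-state c p d)
      all-receiving RM p (yes refl) = subst (Receiving M) (sym (cong visible eg)) RM
      all-receiving RM p (no p≢H) = Relabel.dir-unlift ι (machine S₁ p) (transport-dir (eP p p≢H) (receiving (ι p)))

  final-interface : ∀ c → (∀ p → Final (machine S p) (st c p)) → ∃ λ q → gwState c ≡ inj₁ q × Final M q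
  final-interface c all-final = final-state (gwState c) (transport-final eH (all-final (ι H)))

  orphan-side : Safe S₁ → ∀ c → Reachable S c → (∀ p → Final (machine S p) (st c p)) →
                ∀ x y → x ≢ y → ch c (ι x) (ι y) ≢ [] → ⊥
  orphan-side safe c r all-final x y x≢y nonempty with final-interface c all-final
  ... | q , eg , FM = proj₁ (proj₂ (safe-projection safe r))
                        ((λ p → all-final' p (decEq P p H)) , x , y , x≢y , nonempty)
    where
      all-final' : ∀ p d → Final (machine S₁ p) (project-state c p d)
      all-final' p (yes refl) = subst (Final M) (sym (cong visible eg)) FM
      all-final' p (no p≢H) = Relabel.final-unlift ι (machine S₁ p) (transport-final (eP p p≢H) (all-final (ι p)))

  HeadSendable : Config S → Set
  HeadSendable c = ∀ q → gwState c ≡ inj₁ q → Sending M q → ∀ b w → fromK c ≡ b ∷ w →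
                   ∃ λ l → ∃ λ q' → (q , l , q') ∈ δ M × dir l ≡ snd × msg l ≡ b

  -- An unspecified reception by a role of S₁ is one of S₁, unless H's gateway waits for K' on
  -- behalf of a sending state of M; then the head of the channel from K' is sendable by M, so
  -- the gateway can receive it after all.
  unspecified-side : NoMixed M → Safe S₁ → ∀ c → Reachable S c → ∀ x →
    Receiving (machine S (ι x)) (st c (ι x)) → Unserved c (ι x) → HeadSendable c → ⊥
  unspecified-side NM safe c r x receiving unserved head-sendable with decEq P x H
  ... | no x≢H = proj₂ (proj₂ (safe-projection safe r)) (x , receiving' , unserved')
    where
      receiving' : Receiving (machine S₁ x) (st (project c) x)
      receiving' = subst (Receiving (machine S₁ x)) (sym (project-other c x x≢H))
                     (Relabel.dir-unlift ι (machine S₁ x) (transport-dir (eP x x≢H) receiving))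
      unserved' : Unserved (project c) x
      unserved' s a q' t = unserved (ι s) a _ (transport-trans⁻ (eP x x≢H)
        (Relabel.lift-trans ι (machine S₁ x) (subst (λ u → (u , _ , _) ∈ _) (project-other c x x≢H) t)))
  ... | yes refl with receiving-state (gwState c) (transport-dir eH receiving)
  ... | q , eg , nonfinal = NM q (nonfinal , sending-case , receiving-case)
    where
      receiving-case : Receiving M q → ⊥
      receiving-case RM = proj₂ (proj₂ (safe-projection safe r))
        (H , subst (Receiving M) (sym (visible-orig c eg)) RM ,
         λ s a q' t → unserved (ι s) a _
           (gateway-from c eg (proj₂ (forward-recv (subst (λ u → (u , _ , _) ∈ δ M) (visible-orig c eg) t)))))

      sending-case : Sending M q → ⊥
      sending-case SM = proj₁ SM (λ l (_ , t) → blocked t (proj₂ SM l (_ , t)))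
        where
          blocked : ∀ {l q'} → (q , l , q') ∈ δ M → dir l ≡ snd → ⊥
          blocked {act _ _ snd a} t refl = by-channel (fromK c) refl
            where
              by-channel : ∀ xs → fromK c ≡ xs → ⊥
              by-channel [] e = proj₁ (unserved K' a _ (gateway-from c eg (proj₂ (forward-send t)))) e
              by-channel (b ∷ w) e with head-sendable q eg SM b w e
              ... | act _ _ snd _ , _ , t' , refl , refl =
                proj₂ (unserved K' b _ (gateway-from c eg (proj₂ (forward-send t')))) (w , e)

module Composition {A : Set} {P₁ P₂ : FinSet} (S₁ : System P₁ A) (S₂ : System P₂ A)
                   (H : Carrier P₁) (K : Carrier P₂) where

  S : System (P₁ ⊎F P₂) A
  S = compose S₁ S₂ H K

  machine-H : machine S (inj₁ H) ≡ gateway inj₁ (decEq P₁) H (inj₂ K) (machine S₁ H)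
  machine-H with decEq P₁ H H
  ... | yes _ = refl
  ... | no H≢H = ⊥-elim (H≢H refl)

  machine-P₁ : ∀ p → p ≢ H → machine S (inj₁ p) ≡ liftCFSM inj₁ (machine S₁ p)
  machine-P₁ p p≢H with decEq P₁ p H
  ... | yes p≡H = ⊥-elim (p≢H p≡H)
  ... | no _ = refl

  machine-K : machine S (inj₂ K) ≡ gateway inj₂ (decEq P₂) K (inj₁ H) (machine S₂ K)
  machine-K with decEq P₂ K K
  ... | yes _ = refl
  ... | no K≢K = ⊥-elim (K≢K refl)

  machine-P₂ : ∀ p → p ≢ K → machine S (inj₂ p) ≡ liftCFSM inj₂ (machine S₂ p)
  machine-P₂ p p≢K with decEq P₂ p K
  ... | yes p≡K = ⊥-elim (p≢K p≡K)
  ... | no _ = refl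

  private
    split₁ : ∀ (z : Carrier P₁ ⊎ Carrier P₂) → (∃ λ x → z ≡ inj₁ x) ⊎ (∃ λ y → z ≡ inj₂ y)
    split₁ (inj₁ x) = inj₁ (x , refl)
    split₁ (inj₂ y) = inj₂ (y , refl)

    split₂ : ∀ (z : Carrier P₁ ⊎ Carrier P₂) → (∃ λ x → z ≡ inj₂ x) ⊎ (∃ λ y → z ≡ inj₁ y)
    split₂ (inj₁ x) = inj₂ (x , refl)
    split₂ (inj₂ y) = inj₁ (y , refl)

  module Safety (WF₁ : WellFormed S₁) (WF₂ : WellFormed S₂) (C : Compatible (machine S₁ H) (machine S₂ K))
                (safe₁ : Safe S₁) (safe₂ : Safe S₂) where

    module S1 = Side (P₁ ⊎F P₂) P₁ P₂ S S₁ inj₁ inj₂ inj₁-injective inj₂-injective (λ ()) split₁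
                     H K machine-H machine-P₁ WF₁
    module S2 = Side (P₁ ⊎F P₂) P₂ P₁ S S₂ inj₂ inj₁ inj₂-injective inj₁-injective (λ ()) split₂
                     K H machine-K machine-P₂ WF₂

    M : CFSM (Carrier P₁) A
    M = machine S₁ H

    N : CFSM (Carrier P₂) A
    N = machine S₂ K

    Invariant : Config S → Set
    Invariant c = ∃ λ w̃ → ∃ λ ũ →
      S1.Explains c ⌊ ũ ⌋ (S2.pending (S2.gwState c)) w̃ × Path N (q0 N) ũ (S2.committed (S2.gwState c))

    mirror : ∀ {c w̃ ũ} → S1.Explains c ⌊ ũ ⌋ (S2.pending (S2.gwState c)) w̃ →
             Path N (q0 N) ũ (S2.committed (S2.gwState c)) → S2.Explains c ⌊ w̃ ⌋ (S1.pending (S1.gwState c)) ũ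
    mirror (S1.explains pw e₁ e₂) pu = S2.explains pu e₂ e₁

    invariant-initial : ∀ c → IsInitial c → Invariant c
    invariant-initial c ini with S1.explains-initial c ini | S2.explains-initial c ini
    ... | S1.explains pw e₁ e₂ | S2.explains pu f₁ f₂ = [] , [] , S1.explains pw e₁ f₁ , pu

    step-on-side₁ : ∀ {c c'} (s : Step c c') x → actor s ≡ inj₁ x → Invariant c → Invariant c'
    step-on-side₁ s x actor≡ (w̃ , ũ , ex , pu) =
      let gw₂≡ = S2.gwState-across-step s x actor≡
          w̃' , ex' = S1.explains-own-step s x actor≡ (cong S2.pending gw₂≡) ex
      in w̃' , ũ , ex' , subst (Path N (q0 N) ũ) (cong S2.committed (sym gw₂≡)) pu

    step-on-side₂ : ∀ {c c'} (s : Step c c') y → actor s ≡ inj₂ y → Invariant c → Invariant c'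
    step-on-side₂ s y actor≡ (w̃ , ũ , ex , pu) =
      let gw₁≡ = S1.gwState-across-step s y actor≡
          ũ' , ex' = S2.explains-own-step s y actor≡ (cong S1.pending gw₁≡) (mirror ex pu)
          pw' = subst (Path M (q0 M) w̃) (cong S1.committed (sym gw₁≡)) (S1.Explains.run ex)
      in w̃ , ũ' , S1.explains pw' (S2.Explains.via-fromK ex') (S2.Explains.via-toK ex') , S2.Explains.run ex'

    invariant-step : ∀ {c c'} → Step c c' → Invariant c → Invariant c'
    invariant-step s with split₁ (actor s)
    ... | inj₁ (x , actor≡) = step-on-side₁ s x actor≡
    ... | inj₂ (y , actor≡) = step-on-side₂ s y actor≡

    invariant : ∀ {c} → Reachable S c → Invariant c × S1.CrossEmpty c × S2.CrossEmpty c
    invariant (c₀ , ini , steps) = go (invariant-initial c₀ ini , S1.cross-initial c₀ ini , S2.cross-initial c₀ ini) steps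
      where
        go : ∀ {c c'} → Invariant c × S1.CrossEmpty c × S2.CrossEmpty c → Star (Step {S = S}) c c' →
             Invariant c' × S1.CrossEmpty c' × S2.CrossEmpty c'
        go i ε = i
        go (i , x₁ , x₂) (s ◅ ss) = go (invariant-step s i , S1.cross-step s x₁ , S2.cross-step s x₂) ss

    safe : Safe S
    safe c r with invariant r
    ... | (w̃ , ũ , ex , pu) , cross₁ , cross₂ = no-deadlock , no-orphan , no-unspecified
      where
        toN toM : List A
        toN = S1.toK c ++ S1.pending (S1.gwState c)
        toM = S1.fromK c ++ S2.pending (S2.gwState c)

        module M↔N = Interface.InTransit M N C (S1.Explains.run ex) pu toN toM
                       (S1.Explains.via-toK ex) (S1.Explains.via-fromK ex)
        module N↔M = Interface.InTransit N M (compatible-sym C) pu (S1.Explains.run ex) toM toN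
                       (S1.Explains.via-fromK ex) (S1.Explains.via-toK ex)

        nmM : NoMixed M
        nmM = proj₁ (proj₂ (proj₂ C))

        nmN : NoMixed N
        nmN = proj₁ (proj₂ (proj₂ (proj₂ C)))

        -- In a deadlock both gateways rest in sending states with nothing in transit.
        no-deadlock : ¬ Deadlock c
        no-deadlock D with S1.deadlock-interface nmM safe₁ c r D | S2.deadlock-interface nmN safe₂ c r D
        ... | q , eg , ¬¬SM | q' , eg' , ¬¬SN = ¬¬SM λ SM → ¬¬SN λ SN →
          M↔N.not-both-sending
            (cong₂ _++_ (proj₁ D _ _ (λ ())) (cong S1.pending eg))
            (cong₂ _++_ (proj₁ D _ _ (λ ())) (cong S2.pending eg'))
            (subst (Sending M) (sym (cong S1.committed eg)) SM)
            (subst (Sending N) (sym (cong S2.committed eg')) SN)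

        -- A message left inside one side is ruled out by the safety of that side; one on the
        -- interface channel would mean the receiving side is not final.
        no-orphan : ¬ OrphanMessage c
        no-orphan (all-final , inj₁ x , inj₁ y , x≢y , nonempty) =
          S1.orphan-side safe₁ c r all-final x y (λ e → x≢y (cong inj₁ e)) nonempty
        no-orphan (all-final , inj₂ x , inj₂ y , x≢y , nonempty) =
          S2.orphan-side safe₂ c r all-final x y (λ e → x≢y (cong inj₂ e)) nonempty
        no-orphan (all-final , inj₁ x , inj₂ y , _ , nonempty) with decEq P₁ x H | decEq P₂ y K
        ... | yes refl | yes refl =
          let q' , eg' , FN = S2.final-interface c all-final
          in M↔N.partner-not-final (λ e → nonempty (++-conicalˡ _ _ e))
               (subst (Final N) (sym (cong S2.committed eg')) FN)
        ... | no x≢H | _ = nonempty (cross₁ x y (λ both → x≢H (proj₁ both)))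
        ... | yes _ | no y≢K = nonempty (cross₁ x y (λ both → y≢K (proj₂ both)))
        no-orphan (all-final , inj₂ x , inj₁ y , _ , nonempty) with decEq P₂ x K | decEq P₁ y H
        ... | yes refl | yes refl =
          let q , eg , FM = S1.final-interface c all-final
          in N↔M.partner-not-final (λ e → nonempty (++-conicalˡ _ _ e))
               (subst (Final M) (sym (cong S1.committed eg)) FM)
        ... | no x≢K | _ = nonempty (cross₂ x y (λ both → x≢K (proj₁ both)))
        ... | yes _ | no y≢H = nonempty (cross₂ x y (λ both → y≢H (proj₂ both)))

        no-unspecified : ¬ UnspecifiedReception c
        no-unspecified (inj₁ x , receiving , unserved) =
          S1.unspecified-side nmM safe₁ c r x receiving unserved λ q eg SM b w e →
            subst (λ q → ∃ λ l → ∃ λ q' → (q , l , q') ∈ δ M × dir l ≡ snd × msg l ≡ b) (cong S1.committed eg)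
              (M↔N.head-sendable (cong (_++ _) e) (subst (Sending M) (sym (cong S1.committed eg)) SM))
        no-unspecified (inj₂ x , receiving , unserved) =
          S2.unspecified-side nmN safe₂ c r x receiving unserved λ q eg SN b w e →
            subst (λ q → ∃ λ l → ∃ λ q' → (q , l , q') ∈ δ N × dir l ≡ snd × msg l ≡ b) (cong S2.committed eg)
              (N↔M.head-sendable (cong (_++ _) e) (subst (Sending N) (sym (cong S2.committed eg)) SN))

module _ {A : Set} (F : GTFormalism A) where

  interface-behaviour : ∀ (𝐆 : GTIR F) H → ifaceGTIR F 𝐆 H →
                        SameBehaviour (proj₂ (projGTIR F 𝐆 H)) (machine (⟦_⟧ F 𝐆) H)
  interface-behaviour (base G I _) H _ = same-refl (proj F G H)
  interface-behaviour (comp 𝐆₁ 𝐆₂ H' _ K' _ _) (inj₁ p) (hp , p≢H') =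
    same-trans (interface-behaviour 𝐆₁ p hp)
      (subst (SameBehaviour _) (sym (Composition.machine-P₁ (⟦_⟧ F 𝐆₁) (⟦_⟧ F 𝐆₂) H' K' p p≢H'))
        (relabel-same inj₁ (machine (⟦_⟧ F 𝐆₁) p)))
  interface-behaviour (comp 𝐆₁ 𝐆₂ H' _ K' _ _) (inj₂ p) (hp , p≢K') =
    same-trans (interface-behaviour 𝐆₂ p hp)
      (subst (SameBehaviour _) (sym (Composition.machine-P₂ (⟦_⟧ F 𝐆₁) (⟦_⟧ F 𝐆₂) H' K' p p≢K'))
        (relabel-same inj₂ (machine (⟦_⟧ F 𝐆₂) p)))

composition-safe : ∀ (𝔸 P₁ P₂ : FinSet) (S₁ : System P₁ (Carrier 𝔸)) (S₂ : System P₂ (Carrier 𝔸))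
  (H : Carrier P₁) (K : Carrier P₂) → Compatible (machine S₁ H) (machine S₂ K) →
  WellFormed S₁ → WellFormed S₂ → Safe S₁ → Safe S₂ → Safe (compose S₁ S₂ H K)
composition-safe 𝔸 P₁ P₂ S₁ S₂ H K C WF₁ WF₂ safe₁ safe₂ =
  Composition.Safety.safe S₁ S₂ H K WF₁ WF₂ C safe₁ safe₂

-- (2) The semantics of a composed GTIR is safe when its components' semantics are: the
-- compatibility of the projections carries over to the interface machines of the semantics.
gtir-safe : ∀ (𝔸 : FinSet) (F : GTFormalism (Carrier 𝔸)) (𝐆₁ 𝐆₂ : GTIR F)
  (H : Carrier (rolesGTIR F 𝐆₁)) (hH : ifaceGTIR F 𝐆₁ H)
  (K : Carrier (rolesGTIR F 𝐆₂)) (kK : ifaceGTIR F 𝐆₂ K)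
  (c : Compatible (proj₂ (projGTIR F 𝐆₁ H)) (proj₂ (projGTIR F 𝐆₂ K))) →
  WellFormed (⟦_⟧ F 𝐆₁) → WellFormed (⟦_⟧ F 𝐆₂) → Safe (⟦_⟧ F 𝐆₁) → Safe (⟦_⟧ F 𝐆₂) →
  Safe (⟦_⟧ F (comp 𝐆₁ 𝐆₂ H hH K kK c))
gtir-safe 𝔸 F 𝐆₁ 𝐆₂ H hH K kK c =
  composition-safe 𝔸 _ _ (⟦_⟧ F 𝐆₁) (⟦_⟧ F 𝐆₂) H K
    (compatible-resp (interface-behaviour F 𝐆₁ H hH) (interface-behaviour F 𝐆₂ K kK) c)

corollary3 :
    (∀ (𝔸 P₁ P₂ : FinSet) (S₁ : System P₁ (Carrier 𝔸)) (S₂ : System P₂ (Carrier 𝔸))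
       (H : Carrier P₁) (K : Carrier P₂) →
       Compatible (machine S₁ H) (machine S₂ K) →
       WellFormed S₁ → WellFormed S₂ →
       Safe S₁ → Safe S₂ → Safe (compose S₁ S₂ H K))
    ×
    (∀ (𝔸 : FinSet) (F : GTFormalism (Carrier 𝔸)) (𝐆₁ 𝐆₂ : GTIR F)
       (H : Carrier (rolesGTIR F 𝐆₁)) (hH : ifaceGTIR F 𝐆₁ H)
       (K : Carrier (rolesGTIR F 𝐆₂)) (kK : ifaceGTIR F 𝐆₂ K)
       (c : Compatible (proj₂ (projGTIR F 𝐆₁ H)) (proj₂ (projGTIR F 𝐆₂ K))) →
       WellFormed (⟦_⟧ F 𝐆₁) → WellFormed (⟦_⟧ F 𝐆₂) →
       Safe (⟦_⟧ F 𝐆₁) → Safe (⟦_⟧ F 𝐆₂) →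
       Safe (⟦_⟧ F (comp 𝐆₁ 𝐆₂ H hH K kK c)))
corollary3 = composition-safe , gtir-safe
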